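{- Let $\mathcal C\le\mathbb F_{q^m}^n$ be an $\mathbb F_{q^m}$-linear rank metric code and $\mathcal M$ its induced $q$-matroid on $\mathbb F_q^n$. For every subspace $W\le\mathbb F_q^n$ and every positive integer $t$, the number of ordered $t$-tuples $(v_1,\dots,v_t)$ with $v_j\in\mathcal C$ for all $j$ such that $S_R(\{v_1,\dots,v_t\})=W$ equals $\chi_{\mathcal M/W^\perp}(q^{mt})$.
   Context: $\mathbb F_{q^m}$ is the degree-$m$ extension of the finite field $\mathbb F_q$, and $\Gamma$ is a fixed $\mathbb F_q$-basis of $\mathbb F_{q^m}$. For $v=(v_1,\dots,v_n)\in\mathbb F_{q^m}^n$, $\Gamma(v)$ is the $n\times m$ matrix over $\mathbb F_q$ whose $i$-th row is the coordinate vector of $v_i$ with respect to $\Gamma$. The rank support is $S_R(v)=\mathrm{colsp}_{\mathbb F_q}(\Gamma(v))\le\mathbb F_q^n$, and for a set $V$, $S_R(V)=\sum_{v\in V}S_R(v)$. An $\mathbb F_{q^m}$-linear rank metric code is an $\mathbb F_{q^m}$-subspace $\mathcal C\le\mathbb F_{q^m}^n$; let $G\in\mathbb F_{q^m}^{k\times n}$ be a matrix whose row space is $\mathcal C$. The induced $q$-matroid is $\mathcal M=(\mathbb F_q^n,\rho)$ with $\rho(V)=\mathrm{rk}_{\mathbb F_{q^m}}(G\,Y_V)$, where $Y_V$ is any matrix over $\mathbb F_q$ whose columns span $V$. Orthogonal complements $W^\perp$ are taken with respect to the standard dot product on $\mathbb F_q^n$. A $q$-matroid is a pair $(E,\rho)$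 with $\rho$ a function on subspaces satisfying $0\le\rho(V)\le\dim V$, monotonicity and submodularity. Contraction: $\mathcal M/U=(E/U,\rho')$ with $\rho'(X)=\rho(\pi^{ -1}(X))-\rho(U)$, $\pi:E\to E/U$ the projection. The characteristic polynomial is $\chi_{\mathcal M}(x)=\sum_{V\le E}\mu_{\mathcal L(E)}(\{0\},V)\,x^{\rho(E)-\rho(V)}$, with $\mu_{\mathcal L(E)}$ the Möbius function of the subspace lattice of the groundspace $E$. -}

module Defs where

open import Data.Bool using (Bool; true; false; if_then_else_; _∧_; _∨_; not)
open import Data.Nat using (ℕ; zero; suc; _∸_; _⊔_)
open import Data.Integer using (ℤ) renaming (_+_ to _+ℤ_; _*_ to _*ℤ_; -_ to -ℤ_; _^_ to _^ℤ_)
import Data.Integer as ℤ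
open import Data.List using (List; []; _∷_; map; _++_; concatMap; length; filterᵇ; foldr; concat)
open import Data.Bool.ListAction using (all; any)
open import Data.List.Membership.Propositional using (_∈_)
open import Data.List.Relation.Unary.Unique.Propositional using (Unique)
open import Data.Vec using (Vec; []; _∷_; lookup; zipWith; replicate; toList)
import Data.Vec as Vec
open import Data.Vec.Properties using (≡-dec)
open import Data.Fin using (Fin)
open import Data.Product using (Σ)
open import Relation.Binary.PropositionalEquality using (_≡_)
open import Relation.Binary.Definitions using (DecidableEquality)
open import Relation.Nullary using (¬_; does)
open import Algebra.Core using (Op₁; Op₂)
open import Algebra.Structures using (IsCommutativeRing)

record Field : Set₁ where
  field
    Carrier : Set
    _+_ _*_ : Op₂ Carrier
    -_ : Op₁ Carrier
    0# 1# : Carrier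
    isCommutativeRing : IsCommutativeRing _≡_ _+_ _*_ -_ 0# 1#
    0≢1 : ¬ (0# ≡ 1#)
    inverse : ∀ x → ¬ (x ≡ 0#) → Σ Carrier (λ y → x * y ≡ 1#)
    _≟_ : DecidableEquality Carrier

record FiniteField : Set₁ where
  field
    field' : Field
  open Field field' public
  field
    elems : List Carrier
    elems-complete : ∀ x → x ∈ elems
    elems-unique : Unique elems

  q : ℕ
  q = length elems

allVecs : {A : Set} → List A → (n : ℕ) → List (Vec A n)
allVecs xs zero = [] ∷ []
allVecs xs (suc n) = concatMap (λ x → map (x ∷_) (allVecs xs n)) xs

sublists : {A : Set} → List A → List (List A)
sublists [] = [] ∷ []
sublists (x ∷ xs) = map (x ∷_) (sublists xs) ++ sublists xs

maximum : List ℕ → ℕ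
maximum = foldr _⊔_ 0

sumℤ : List ℤ → ℤ
sumℤ = foldr _+ℤ_ (ℤ.+ 0)

module VecOps (F : Field) where
  open Field F

  zeroV : ∀ {n} → Vec Carrier n
  zeroV = replicate _ 0#

  _+V_ : ∀ {n} → Vec Carrier n → Vec Carrier n → Vec Carrier n
  _+V_ = zipWith _+_

  _·V_ : ∀ {n} → Carrier → Vec Carrier n → Vec Carrier n
  c ·V v = Vec.map (c *_) v

  dot : ∀ {n} → Vec Carrier n → Vec Carrier n → Carrier
  dot u v = Vec.foldr _ _+_ 0# (zipWith _*_ u v)

  lincomb : ∀ {n} → List Carrier → List (Vec Carrier n) → Vec Carrier n
  lincomb (c ∷ cs) (v ∷ vs) = (c ·V v) +V lincomb cs vs
  lincomb _ _ = zeroV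

  eqᵇ : ∀ {n} → Vec Carrier n → Vec Carrier n → Bool
  eqᵇ u v = does (≡-dec _≟_ u v)

  isZeroᵇ : Carrier → Bool
  isZeroᵇ x = does (x ≟ 0#)

record Extension (K : FiniteField) (m : ℕ) : Set₁ where
  module K = FiniteField K
  field
    L : Field
  module L = Field L
  field
    ι : K.Carrier → L.Carrier
    ι-+ : ∀ a b → ι (a K.+ b) ≡ ι a L.+ ι b
    ι-* : ∀ a b → ι (a K.* b) ≡ ι a L.* ι b
    ι-1 : ι K.1# ≡ L.1#
    Γ : Vec L.Carrier m
  comb : Vec K.Carrier m → L.Carrier
  comb a = Vec.foldr _ L._+_ L.0# (zipWith (λ ai γ → ι ai L.* γ) a Γ)
  field
    -- Γ is an F_q-basis: every element has unique coordinates
    coord : L.Carrier → Vec K.Carrier m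
    comb-coord : ∀ x → comb (coord x) ≡ x
    coord-comb : ∀ a → coord (comb a) ≡ a

  elemsL : List L.Carrier
  elemsL = map comb (allVecs K.elems m)

record LatticeRank : Set₁ where
  field
    P : Set
    elems : List P
    _≤ᵇ_ : P → P → Bool
    _=ᵇ_ : P → P → Bool
    bot top : P
    rk : P → ℕ

  -- The fuel (length of the element list) bounds the length of strict chains,
  -- so it never runs out.
  μ' : ℕ → P → P → ℤ
  μ' zero a b = if a =ᵇ b then ℤ.+ 1 else ℤ.+ 0
  μ' (suc f) a b =
    if a =ᵇ b then ℤ.+ 1
    else if a ≤ᵇ b
      then -ℤ sumℤ (map (μ' f a) (filterᵇ (λ c → (a ≤ᵇ c) ∧ (c ≤ᵇ b) ∧ not (c =ᵇ b)) elems))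
      else ℤ.+ 0

  μ : P → P → ℤ
  μ = μ' (length elems)

  charPoly : ℤ → ℤ
  charPoly x = sumℤ (map (λ V → μ bot V *ℤ (x ^ℤ (rk top ∸ rk V))) elems)

-- Subspaces of F_q^n, represented by the list of their elements
-- (a sub-list of the canonical enumeration allVecs K.elems n).

module Subspaces (K : FiniteField) (n : ℕ) where
  open FiniteField K
  open VecOps field'

  Vn : Set
  Vn = Vec Carrier n

  E : List Vn
  E = allVecs elems n

  memᵇ : Vn → List Vn → Bool
  memᵇ x S = any (eqᵇ x) S

  isSubspaceᵇ : List Vn → Bool
  isSubspaceᵇ S = memᵇ zeroV S ∧
    all (λ x → all (λ y → all (λ c → memᵇ (x +V (c ·V y)) S) elems) S) S

  subspaces : List (List Vn)
  subspaces = filterᵇ isSubspaceᵇ (sublists E)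

  _⊆ᵇ_ : List Vn → List Vn → Bool
  U ⊆ᵇ V = all (λ x → memᵇ x V) U

  sameᵇ : List Vn → List Vn → Bool
  sameᵇ U V = (U ⊆ᵇ V) ∧ (V ⊆ᵇ U)

  orth : List Vn → List Vn
  orth W = filterᵇ (λ x → all (λ w → isZeroᵇ (dot x w)) W) E

  inSpanᵇ : List Vn → Vn → Bool
  inSpanᵇ vs x = any (λ cs → eqᵇ (lincomb (toList cs) vs) x) (allVecs elems (length vs))

  span : List Vn → List Vn
  span vs = filterᵇ (inSpanᵇ vs) E

module Rank (F : Field) (elemsF : List (Field.Carrier F)) (k : ℕ) where
  open Field F
  open VecOps F

  independentᵇ : List (Vec Carrier k) → Bool
  independentᵇ vs = all (λ cs → not (eqᵇ (lincomb (toList cs) vs) zeroV) ∨ all isZeroᵇ (toList cs))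
                        (allVecs elemsF (length vs))

  rank : List (Vec Carrier k) → ℕ
  rank vs = maximum (map length (filterᵇ independentᵇ (sublists vs)))

module Code {K : FiniteField} {m : ℕ} (Ext : Extension K m) {k n : ℕ}
            (G : Vec (Vec (Field.Carrier (Extension.L Ext)) n) k) where
  open Extension Ext
  open Subspaces K n
  module VL = VecOps L
  module VK = VecOps (FiniteField.field' K)
  open Rank L elemsL k

  Gy : Vn → Vec L.Carrier k
  Gy y = Vec.map (λ row → VL.dot row (Vec.map ι y)) G

  -- ρ(V) = rk_{F_{q^m}} (G Y_V), with Y_V the matrix whose columns are all elements of V
  ρ : List Vn → ℕ
  ρ V = rank (map Gy V)

  inducedQMatroid : LatticeRank
  inducedQMatroid = record
    { P = List Vn ; elems = subspaces ; _≤ᵇ_ = _⊆ᵇ_ ; _=ᵇ_ = sameᵇ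
    ; bot = VK.zeroV ∷ [] ; top = E ; rk = ρ }

  inCᵇ : Vec L.Carrier n → Bool
  inCᵇ v = any (λ c → VL.eqᵇ (VL.lincomb (toList c) (toList G)) v) (allVecs elemsL k)

  codewords : List (Vec L.Carrier n)
  codewords = filterᵇ inCᵇ (allVecs elemsL n)

  columnsΓ : Vec L.Carrier n → List Vn
  columnsΓ v = toList (Vec.map (λ j → Vec.map (λ vi → lookup (coord vi) j) v) (Vec.allFin m))

  SR : ∀ {t} → Vec (Vec L.Carrier n) t → List Vn
  SR vs = span (concat (toList (Vec.map columnsΓ vs)))

  countTuples : (t : ℕ) → List Vn → ℕ
  countTuples t W = length (filterᵇ (λ vs → sameᵇ (SR vs) W) (allVecs codewords t))

-- Contraction M/U.  The subspaces of E/U are identified with the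
-- subspaces X of E containing U (via π^{-1}); ρ'(X/U) = ρ(X) - ρ(U).

contract : (M : LatticeRank) → LatticeRank.P M → LatticeRank
contract M U = record
  { P = P ; elems = filterᵇ (U ≤ᵇ_) elems ; _≤ᵇ_ = _≤ᵇ_ ; _=ᵇ_ = _=ᵇ_
  ; bot = U ; top = top ; rk = λ X → rk X ∸ rk U }
  where open LatticeRank M

-- A t-tuple of codewords has rank support inside V⊥ iff each entry lies in the subcode C_V of
-- codewords annihilating ι(V); by rank–nullity for G·Y_V, |C_V| = q^(m(ρ(E) − ρ(V))), so there are
-- x^(ρ(E) − ρ(V)) such tuples with x = q^(mt), which is the term of χ_{M/W⊥}(x) at V ⊇ W⊥.
-- Summing these terms against μ(W⊥, V) and exchanging the sums, each tuple τ contributes the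
-- Möbius sum over the interval [W⊥, S_R(τ)⊥], which is 1 exactly when S_R(τ)⊥ = W⊥, i.e. S_R(τ) = W.
module Submission where

open import Defs
open import Data.Bool using (T; _∧_)
open import Data.Nat using (ℕ)
open import Data.Vec using (Vec)
open import Data.List using (List)
open import Data.List.Membership.Propositional using (_∈_)
open import Relation.Binary.PropositionalEquality using (_≡_)

module Counting where

  open import Data.Bool using (Bool; true; false; T; _∧_)
  open import Data.Bool.Properties using (T-∧)
  open import Data.Nat using (ℕ; suc; _+_; _*_; _≤_; _<_; z≤n; s≤s)
  open import Data.Nat.Properties
  open import Algebra.Properties.CommutativeSemigroup +-commutativeSemigroup using (interchange)
  open import Data.List using (List; []; _∷_; map; _++_; concatMap; length; filterᵇ)
  open import Data.Bool.ListAction using (all; any)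
  open import Data.List.Membership.Propositional using (_∈_; find; lose)
  open import Data.List.Relation.Unary.Any using (Any; here; there)
  open import Data.List.Relation.Unary.Any.Properties using (any⁺; any⁻)
  open import Data.List.Relation.Unary.All using (All; []; _∷_)
  import Data.List.Relation.Unary.All as All
  open import Data.List.Relation.Unary.All.Properties using (all⁺; all⁻)
  open import Data.Vec using ([]; _∷_)
  open import Data.Product using (_×_; _,_; proj₁; proj₂; ∃)
  open import Data.Sum using (_⊎_; inj₁; inj₂)
  open import Data.Empty using (⊥-elim)
  open import Data.Unit using (tt)
  open import Relation.Binary.PropositionalEquality
  open import Relation.Binary.Definitions using (DecidableEquality)
  open import Relation.Nullary using (¬_; does; yes; no)
  open import Function using (_∘_; Equivalence)

  𝟙 : Bool → ℕ
  𝟙 true = 1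
  𝟙 false = 0

  ∑ : {A : Set} → List A → (A → ℕ) → ℕ
  ∑ [] f = 0
  ∑ (x ∷ xs) f = f x + ∑ xs f

  module _ {A : Set} where
    ∑-++ : ∀ (xs ys : List A) f → ∑ (xs ++ ys) f ≡ ∑ xs f + ∑ ys f
    ∑-++ [] ys f = refl
    ∑-++ (x ∷ xs) ys f rewrite ∑-++ xs ys f = sym (+-assoc (f x) _ _)

    ∑-cong : ∀ (xs : List A) {f g} → (∀ x → x ∈ xs → f x ≡ g x) → ∑ xs f ≡ ∑ xs g
    ∑-cong [] h = refl
    ∑-cong (x ∷ xs) h = cong₂ _+_ (h x (here refl)) (∑-cong xs (λ y m → h y (there m)))

    ∑-+ : ∀ (xs : List A) f g → ∑ xs (λ x → f x + g x) ≡ ∑ xs f + ∑ xs g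
    ∑-+ [] f g = refl
    ∑-+ (x ∷ xs) f g rewrite ∑-+ xs f g = interchange (f x) (g x) (∑ xs f) (∑ xs g)

    ∑-*ˡ : ∀ (xs : List A) c f → ∑ xs (λ x → c * f x) ≡ c * ∑ xs f
    ∑-*ˡ [] c f = sym (*-zeroʳ c)
    ∑-*ˡ (x ∷ xs) c f rewrite ∑-*ˡ xs c f = sym (*-distribˡ-+ c (f x) (∑ xs f))

    ∑-*ʳ : ∀ (xs : List A) c f → ∑ xs (λ x → f x * c) ≡ ∑ xs f * c
    ∑-*ʳ [] c f = refl
    ∑-*ʳ (x ∷ xs) c f rewrite ∑-*ʳ xs c f = sym (*-distribʳ-+ c (f x) (∑ xs f))

    ∑-0 : ∀ (xs : List A) → ∑ xs (λ _ → 0) ≡ 0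
    ∑-0 [] = refl
    ∑-0 (x ∷ xs) = ∑-0 xs

    ∑-1≡length : ∀ (xs : List A) → ∑ xs (λ _ → 1) ≡ length xs
    ∑-1≡length [] = refl
    ∑-1≡length (x ∷ xs) = cong suc (∑-1≡length xs)

    ∑-mono : ∀ (xs : List A) {f g} → (∀ x → x ∈ xs → f x ≤ g x) → ∑ xs f ≤ ∑ xs g
    ∑-mono [] h = z≤n
    ∑-mono (x ∷ xs) h = +-mono-≤ (h x (here refl)) (∑-mono xs (λ y m → h y (there m)))

    ∑-term : ∀ (xs : List A) f x → x ∈ xs → f x ≤ ∑ xs f
    ∑-term (y ∷ xs) f x (here refl) = m≤m+n (f x) _
    ∑-term (y ∷ xs) f x (there m) = ≤-trans (∑-term xs f x m) (m≤n+m _ (f y))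

    ∑-filter : ∀ (p : A → Bool) (xs : List A) f → ∑ (filterᵇ p xs) f ≡ ∑ xs (λ x → 𝟙 (p x) * f x)
    ∑-filter p [] f = refl
    ∑-filter p (x ∷ xs) f with p x
    ... | true = cong₂ _+_ (sym (*-identityˡ (f x))) (∑-filter p xs f)
    ... | false = ∑-filter p xs f

    length-filter : ∀ (p : A → Bool) (xs : List A) → length (filterᵇ p xs) ≡ ∑ xs (λ x → 𝟙 (p x))
    length-filter p xs = trans (sym (∑-1≡length (filterᵇ p xs))) (trans (∑-filter p xs (λ _ → 1)) (∑-cong xs (λ x _ → *-identityʳ (𝟙 (p x)))))

  module _ {A B : Set} where
    ∑-map : ∀ (g : A → B) (xs : List A) f → ∑ (map g xs) f ≡ ∑ xs (f ∘ g)
    ∑-map g [] f = refl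
    ∑-map g (x ∷ xs) f = cong (f (g x) +_) (∑-map g xs f)

    ∑-concatMap : ∀ (g : A → List B) (xs : List A) f → ∑ (concatMap g xs) f ≡ ∑ xs (λ x → ∑ (g x) f)
    ∑-concatMap g [] f = refl
    ∑-concatMap g (x ∷ xs) f = trans (∑-++ (g x) (concatMap g xs) f) (cong (∑ (g x) f +_) (∑-concatMap g xs f))

    ∑-swap : ∀ (xs : List A) (ys : List B) (f : A → B → ℕ) → ∑ xs (λ x → ∑ ys (f x)) ≡ ∑ ys (λ y → ∑ xs (λ x → f x y))
    ∑-swap [] ys f = sym (∑-0 ys)
    ∑-swap (x ∷ xs) ys f = trans (cong (∑ ys (f x) +_) (∑-swap xs ys f)) (sym (∑-+ ys (f x) (λ y → ∑ xs (λ x' → f x' y))))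

  𝟙-∧ : ∀ a b → 𝟙 (a ∧ b) ≡ 𝟙 a * 𝟙 b
  𝟙-∧ true b = sym (+-identityʳ (𝟙 b))
  𝟙-∧ false b = refl

  𝟙-mono : ∀ {a b} → (T a → T b) → 𝟙 a ≤ 𝟙 b
  𝟙-mono {true} {true} f = s≤s z≤n
  𝟙-mono {true} {false} f = ⊥-elim (f tt)
  𝟙-mono {false} f = z≤n

  T⇒𝟙≡1 : ∀ {a} → T a → 𝟙 a ≡ 1
  T⇒𝟙≡1 {true} _ = refl

  ¬T⇒𝟙≡0 : ∀ {a} → ¬ T a → 𝟙 a ≡ 0
  ¬T⇒𝟙≡0 {true} h = ⊥-elim (h tt)
  ¬T⇒𝟙≡0 {false} _ = refl

  T-dec : ∀ a → T a ⊎ ¬ T a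
  T-dec true = inj₁ tt
  T-dec false = inj₂ (λ ())

  T-ext : ∀ {a b} → (T a → T b) → (T b → T a) → a ≡ b
  T-ext {true} {true} f g = refl
  T-ext {true} {false} f g = ⊥-elim (f tt)
  T-ext {false} {true} f g = ⊥-elim (g tt)
  T-ext {false} {false} f g = refl

  T-∧-intro : ∀ {a b} → T a → T b → T (a ∧ b)
  T-∧-intro p q = Equivalence.from T-∧ (p , q)

  T-∧-l : ∀ {a b} → T (a ∧ b) → T a
  T-∧-l {a} {b} = proj₁ ∘ Equivalence.to (T-∧ {a} {b})

  T-∧-r : ∀ {a b} → T (a ∧ b) → T b
  T-∧-r {a} {b} = proj₂ ∘ Equivalence.to (T-∧ {a} {b})

  module _ {A : Set} where
    all-T : ∀ (p : A → Bool) xs → T (all p xs) → ∀ x → x ∈ xs → T (p x)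
    all-T p xs h x = All.lookup (all⁺ p xs h)

    T-all : ∀ (p : A → Bool) xs → (∀ x → x ∈ xs → T (p x)) → T (all p xs)
    T-all p xs h = all⁻ p (All.tabulate (h _))

    any-T : ∀ (p : A → Bool) xs → T (any p xs) → ∃ λ x → x ∈ xs × T (p x)
    any-T p xs h = find (any⁻ p xs h)

    T-any : ∀ (p : A → Bool) xs x → x ∈ xs → T (p x) → T (any p xs)
    T-any p xs x m t = any⁺ p (lose m t)

    module DecEq (_≟_ : DecidableEquality A) where
      δ : A → A → ℕ
      δ x y = 𝟙 (does (x ≟ y))

      δ-refl : ∀ x → δ x x ≡ 1
      δ-refl x with x ≟ x
      ... | yes _ = refl
      ... | no ne = ⊥-elim (ne refl)

      δ-≢ : ∀ {x y} → ¬ x ≡ y → δ x y ≡ 0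
      δ-≢ {x} {y} ne with x ≟ y
      ... | yes e = ⊥-elim (ne e)
      ... | no _ = refl

      δ-sym : ∀ x y → δ x y ≡ δ y x
      δ-sym x y with x ≟ y | y ≟ x
      ... | yes _ | yes _ = refl
      ... | yes e | no ne = ⊥-elim (ne (sym e))
      ... | no ne | yes e = ⊥-elim (ne (sym e))
      ... | no _ | no _ = refl

      δ-ext : ∀ {x y u v} → (x ≡ y → u ≡ v) → (u ≡ v → x ≡ y) → δ x y ≡ δ u v
      δ-ext {x} {y} {u} {v} f g with x ≟ y | u ≟ v
      ... | yes _ | yes _ = refl
      ... | yes e | no ne = ⊥-elim (ne (f e))
      ... | no ne | yes e = ⊥-elim (ne (g e))
      ... | no _ | no _ = refl

      T-δ : ∀ {x y} → T (does (x ≟ y)) → x ≡ y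
      T-δ {x} {y} t with x ≟ y
      ... | yes e = e

      δ-T : ∀ {x y} → x ≡ y → T (does (x ≟ y))
      δ-T {x} {y} e with x ≟ y
      ... | yes _ = tt
      ... | no ne = ne e

      memᵇ' : A → List A → Bool
      memᵇ' x ys = any (λ y → does (x ≟ y)) ys

      mem-T : ∀ x ys → T (memᵇ' x ys) → x ∈ ys
      mem-T x ys t = let (y , m , e) = any-T (λ y → does (x ≟ y)) ys t in subst (_∈ ys) (sym (T-δ e)) m

      T-mem : ∀ x ys → x ∈ ys → T (memᵇ' x ys)
      T-mem x ys m = T-any (λ y → does (x ≟ y)) ys x m (δ-T refl)

      Once : List A → A → Set
      Once xs a = ∑ xs (λ x → δ x a) ≡ 1

      once-pick : ∀ xs a (f : A → ℕ) → Once xs a → ∑ xs (λ x → δ x a * f x) ≡ f a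
      once-pick xs a f o = begin
        ∑ xs (λ x → δ x a * f x) ≡⟨ ∑-cong xs (λ x _ → δ-weight x) ⟩
        ∑ xs (λ x → δ x a * f a) ≡⟨ ∑-*ʳ xs (f a) (λ x → δ x a) ⟩
        ∑ xs (λ x → δ x a) * f a ≡⟨ cong (_* f a) o ⟩
        1 * f a                  ≡⟨ *-identityˡ (f a) ⟩
        f a ∎
        where
        open ≡-Reasoning
        δ-weight : ∀ x → δ x a * f x ≡ δ x a * f a
        δ-weight x with x ≟ a
        ... | yes refl = refl
        ... | no _ = refl

      once-∈ : ∀ xs a → Once xs a → a ∈ xs
      once-∈ [] a ()
      once-∈ (x ∷ xs) a o with x ≟ a
      ... | yes refl = here refl
      ... | no _ = there (once-∈ xs a o)

      ∑-reindex : ∀ (xs : List A) (once : ∀ a → Once xs a) (g h : A → A) → (∀ x → h (g x) ≡ x) → (∀ y → g (h y) ≡ y)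
                → ∀ (f : A → ℕ) → ∑ xs (λ x → f (g x)) ≡ ∑ xs f
      ∑-reindex xs once g h hg gh f = begin
        ∑ xs (λ x → f (g x))
          ≡⟨ ∑-cong xs (λ x _ → sym (once-pick xs (g x) f (once (g x)))) ⟩
        ∑ xs (λ x → ∑ xs (λ y → δ y (g x) * f y))
          ≡⟨ ∑-swap xs xs (λ x y → δ y (g x) * f y) ⟩
        ∑ xs (λ y → ∑ xs (λ x → δ y (g x) * f y))
          ≡⟨ ∑-cong xs (λ y _ → ∑-*ʳ xs (f y) (λ x → δ y (g x))) ⟩
        ∑ xs (λ y → ∑ xs (λ x → δ y (g x)) * f y)
          ≡⟨ ∑-cong xs (λ y _ → cong (_* f y) (trans (∑-cong xs (λ x _ → δ-inverse y x)) (once (h y)))) ⟩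
        ∑ xs (λ y → 1 * f y)
          ≡⟨ ∑-cong xs (λ y _ → *-identityˡ (f y)) ⟩
        ∑ xs f ∎
        where
        open ≡-Reasoning
        δ-inverse : ∀ y x → δ y (g x) ≡ δ x (h y)
        δ-inverse y x = δ-ext (λ e → trans (sym (hg x)) (cong h (sym e))) (λ e → trans (sym (gh y)) (cong g (sym e)))

      ∑-𝟙-unique : ∀ xs (p : A → Bool) a → Once xs a → T (p a) → (∀ x → T (p x) → x ≡ a) → ∑ xs (λ x → 𝟙 (p x)) ≡ 1
      ∑-𝟙-unique xs p a o pa uniq = trans (∑-cong xs (λ x _ → 𝟙≡δ x)) o
        where
        𝟙≡δ : ∀ x → 𝟙 (p x) ≡ δ x a
        𝟙≡δ x with x ≟ a
        ... | yes refl = T⇒𝟙≡1 pa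
        ... | no ne = ¬T⇒𝟙≡0 (λ t → ne (uniq x t))

  module _ {A : Set} where
    count-mono : ∀ (xs : List A) (p q : A → Bool) → (∀ x → x ∈ xs → T (p x) → T (q x)) → ∑ xs (λ x → 𝟙 (p x)) ≤ ∑ xs (λ x → 𝟙 (q x))
    count-mono xs p q h = ∑-mono xs (λ x m → 𝟙-mono (h x m))

    count-≡⇒converse : ∀ (xs : List A) (p q : A → Bool) → (∀ x → x ∈ xs → T (p x) → T (q x)) →
                    ∑ xs (λ x → 𝟙 (p x)) ≡ ∑ xs (λ x → 𝟙 (q x)) → ∀ x → x ∈ xs → T (q x) → T (p x)
    count-≡⇒converse (y ∷ xs) p q h eq x m qx with p y in e1 | q y in e2
    ... | true | true = go m
      where
      go : x ∈ y ∷ xs → T (p x)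
      go (here refl) = subst T (sym e1) tt
      go (there m') = count-≡⇒converse xs p q (λ z m'' → h z (there m'')) (suc-injective eq) x m' qx
    ... | true | false = ⊥-elim (subst T e2 (h y (here refl) (subst T (sym e1) tt)))
    ... | false | false = go m
      where
      go : x ∈ y ∷ xs → T (p x)
      go (here refl) = ⊥-elim (subst T e2 qx)
      go (there m') = count-≡⇒converse xs p q (λ z m'' → h z (there m'')) eq x m' qx
    ... | false | true = ⊥-elim (<-irrefl refl (≤-trans (s≤s (count-mono xs p q (λ z m'' → h z (there m'')))) (≤-reflexive (sym eq))))

    count-strict : ∀ (xs : List A) (p q : A → Bool) → (∀ x → x ∈ xs → T (p x) → T (q x)) → ∀ c → c ∈ xs → T (q c) → ¬ T (p c) →
                   ∑ xs (λ x → 𝟙 (p x)) < ∑ xs (λ x → 𝟙 (q x))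
    count-strict (x ∷ xs) p q h c (here refl) qc npc =
      subst (λ z → z + ∑ xs (λ y → 𝟙 (p y)) < 𝟙 (q x) + ∑ xs (λ y → 𝟙 (q y))) (sym (¬T⇒𝟙≡0 npc))
       (subst (λ z → ∑ xs (λ y → 𝟙 (p y)) < z + ∑ xs (λ y → 𝟙 (q y))) (sym (T⇒𝟙≡1 qc)) (s≤s (count-mono xs p q (λ y m → h y (there m)))))
    count-strict (x ∷ xs) p q h c (there m) qc npc = +-mono-≤-< (𝟙-mono (h x (here refl))) (count-strict xs p q (λ y m' → h y (there m')) c m qc npc)

  module _ {A : Set} (_≟_ : DecidableEquality A) where
    open DecEq _≟_
    𝟙-any : ∀ (xs : List A) → (∀ a → Once xs a) → (p : A → Bool) → (∀ a b → T (p a) → T (p b) → a ≡ b) → 𝟙 (any p xs) ≡ ∑ xs (λ x → 𝟙 (p x))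
    𝟙-any xs o p uniq with T-dec (any p xs)
    ... | inj₁ t = let (a , m , pa) = any-T p xs t in trans (T⇒𝟙≡1 t) (sym (∑-𝟙-unique xs p a (o a) pa (λ x px → uniq x a px pa)))
    ... | inj₂ nt = trans (¬T⇒𝟙≡0 nt) (sym (trans (∑-cong xs (λ x m → ¬T⇒𝟙≡0 (λ px → nt (T-any p xs x m px)))) (∑-0 xs)))

module Enumeration where

  open import Data.Bool using (Bool; true; false; T)
  open import Data.Nat using (ℕ; zero; suc; _+_; _*_; _≤_; _^_)
  open import Data.Nat.Properties
  open import Data.List using (List; []; _∷_; map; _++_; length; filterᵇ)
  open import Data.Bool.ListAction using (all)
  open import Data.List.Membership.Propositional using (_∈_; _∉_)
  open import Data.List.Relation.Unary.Any using (here; there)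
  open import Data.List.Relation.Unary.All using (All; []; _∷_)
  import Data.List.Relation.Unary.All as All
  open import Data.List.Relation.Unary.Unique.Propositional using (Unique)
  open import Data.List.Relation.Unary.AllPairs using ([]; _∷_)
  open import Data.Vec using (Vec; []; _∷_; toList)
  import Data.Vec.Properties as VecP
  import Data.List.Properties as ListP
  open import Data.Product using (_×_; _,_; ∃; ∃₂)
  open import Data.Sum using (_⊎_; inj₁; inj₂)
  open import Data.Empty using (⊥-elim)
  open import Data.Unit using (tt)
  open import Relation.Binary.PropositionalEquality
  open import Relation.Binary.Definitions using (DecidableEquality)
  open import Relation.Nullary using (¬_; yes; no)
  open import Function using (_∘_)
  open import Data.List.Membership.Propositional.Properties using (∈-++⁺ˡ; ∈-++⁺ʳ; ∈-++⁻; ∈-map⁺; ∈-map⁻; ∈-filter⁺; ∈-filter⁻)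
  open import Data.Bool.Properties using (T?)
  open import Defs using (allVecs; sublists; maximum)
  open Counting

  module _ {A : Set} where
    unique-∉ : ∀ {x : A} {xs} → Unique (x ∷ xs) → x ∉ xs
    unique-∉ (h ∷ _) m = All.lookup h m refl

    unique-tail : ∀ {x : A} {xs} → Unique (x ∷ xs) → Unique xs
    unique-tail (_ ∷ u) = u

    sublist-⊆ : ∀ {xs ys : List A} → ys ∈ sublists xs → ∀ {e} → e ∈ ys → e ∈ xs
    sublist-⊆ {[]} (here refl) ()
    sublist-⊆ {x ∷ xs} {ys} m {e} me with ∈-++⁻ (map (x ∷_) (sublists xs)) m
    ... | inj₁ m1 with ∈-map⁻ (x ∷_) m1
    ...   | zs , mz , refl with me
    ...     | here refl = here refl
    ...     | there me' = there (sublist-⊆ mz me')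
    sublist-⊆ {x ∷ xs} {ys} m {e} me | inj₂ m2 = there (sublist-⊆ m2 me)

    []∈sublists : ∀ (xs : List A) → [] ∈ sublists xs
    []∈sublists [] = here refl
    []∈sublists (x ∷ xs) = ∈-++⁺ʳ (map (x ∷_) (sublists xs)) ([]∈sublists xs)

    filterᵇ∈sublists : ∀ (p : A → Bool) xs → filterᵇ p xs ∈ sublists xs
    filterᵇ∈sublists p [] = here refl
    filterᵇ∈sublists p (x ∷ xs) with p x
    ... | true = ∈-++⁺ˡ (∈-map⁺ (x ∷_) (filterᵇ∈sublists p xs))
    ... | false = ∈-++⁺ʳ (map (x ∷_) (sublists xs)) (filterᵇ∈sublists p xs)

    ∷∈sublists : ∀ {x : A} {xs ys} → ys ∈ sublists xs → (x ∷ ys) ∈ sublists (x ∷ xs)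
    ∷∈sublists m = ∈-++⁺ˡ (∈-map⁺ _ m)

    ∈sublists-skip : ∀ {x : A} {xs ys} → ys ∈ sublists xs → ys ∈ sublists (x ∷ xs)
    ∈sublists-skip {x} {xs} m = ∈-++⁺ʳ (map (x ∷_) (sublists xs)) m

    ∈sublists-∷ : ∀ {x : A} {xs ys} → ys ∈ sublists (x ∷ xs) → (∃ λ zs → ys ≡ x ∷ zs × zs ∈ sublists xs) ⊎ ys ∈ sublists xs
    ∈sublists-∷ {x} {xs} m with ∈-++⁻ (map (x ∷_) (sublists xs)) m
    ... | inj₁ m1 with ∈-map⁻ (x ∷_) m1
    ...   | zs , mz , refl = inj₁ (zs , refl , mz)
    ∈sublists-∷ m | inj₂ m2 = inj₂ m2

    sublist-insert : ∀ {xs ws : List A} {v} → ws ∈ sublists xs → v ∈ xs → v ∉ ws →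
                 ∃₂ λ pre post → ws ≡ pre ++ post × (pre ++ v ∷ post) ∈ sublists xs
    sublist-insert {x ∷ xs} {ws} {v} m (here refl) nm with ∈sublists-∷ {x = x} {xs = xs} m
    ... | inj₁ (zs , refl , _) = ⊥-elim (nm (here refl))
    ... | inj₂ m2 = [] , ws , refl , ∷∈sublists {x = x} {xs = xs} m2
    sublist-insert {x ∷ xs} {ws} {v} m (there mv) nm with ∈sublists-∷ {x = x} {xs = xs} m
    ... | inj₁ (zs , refl , mz) with sublist-insert mz mv (λ h → nm (there h))
    ...   | pre , post , refl , mi = x ∷ pre , post , refl , ∷∈sublists {x = x} {xs = xs} mi
    sublist-insert {x ∷ xs} {ws} {v} m (there mv) nm | inj₂ m2 with sublist-insert m2 mv nm
    ...   | pre , post , refl , mi = pre , post , refl , ∈sublists-skip {x = x} {xs = xs} mi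

    filter-cong : ∀ (xs : List A) (p q : A → Bool) → (∀ x → x ∈ xs → p x ≡ q x) → filterᵇ p xs ≡ filterᵇ q xs
    filter-cong [] p q h = refl
    filter-cong (x ∷ xs) p q h with p x in e1 | q x in e2
    ... | true | true = cong (x ∷_) (filter-cong xs p q (λ y m → h y (there m)))
    ... | false | false = filter-cong xs p q (λ y m → h y (there m))
    ... | true | false = ⊥-elim (true≢false (trans (sym e1) (trans (h x (here refl)) e2)))
      where true≢false : ¬ true ≡ false
            true≢false ()
    ... | false | true = ⊥-elim (false≢true (trans (sym e1) (trans (h x (here refl)) e2)))
      where false≢true : ¬ false ≡ true
            false≢true ()

    module SubDec (_≟_ : DecidableEquality A) where
      open DecEq _≟_

      mem-∉ : ∀ {x ys} → x ∉ ys → memᵇ' x ys ≡ false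
      mem-∉ {x} {ys} nm with memᵇ' x ys in e
      ... | true = ⊥-elim (nm (mem-T x ys (subst T (sym e) tt)))
      ... | false = refl

      mem-∈ : ∀ {x ys} → x ∈ ys → memᵇ' x ys ≡ true
      mem-∈ {x} {ys} m with memᵇ' x ys in e | T-mem x ys m
      ... | true | _ = refl

      sublist-as-filter : ∀ {xs ys : List A} → Unique xs → ys ∈ sublists xs → ys ≡ filterᵇ (λ e → memᵇ' e ys) xs
      sublist-as-filter {[]} u (here refl) = refl
      sublist-as-filter {x ∷ xs} {ys} u m with ∈sublists-∷ {x = x} {xs = xs} m
      ... | inj₁ (zs , refl , mz) rewrite mem-∈ {x} {x ∷ zs} (here refl) =
            cong (x ∷_) (trans (sublist-as-filter (unique-tail u) mz) (filter-cong xs _ _ (λ y my → sym (mem-∷-other y my))))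
        where
        mem-∷-other : ∀ y → y ∈ xs → memᵇ' y (x ∷ zs) ≡ memᵇ' y zs
        mem-∷-other y my with y ≟ x
        ... | yes refl = ⊥-elim (unique-∉ u my)
        ... | no _ = refl
      ... | inj₂ m2 rewrite mem-∉ {x} {ys} (λ h → unique-∉ u (sublist-⊆ m2 h)) = sublist-as-filter (unique-tail u) m2

      sublist-ext : ∀ {xs ys zs : List A} → Unique xs → ys ∈ sublists xs → zs ∈ sublists xs → (∀ e → e ∈ ys → e ∈ zs) → (∀ e → e ∈ zs → e ∈ ys) → ys ≡ zs
      sublist-ext {xs} {ys} {zs} u my mz f g = trans (sublist-as-filter u my) (trans (filter-cong xs _ _ same-members) (sym (sublist-as-filter u mz)))
        where
        same-members : ∀ e → e ∈ xs → memᵇ' e ys ≡ memᵇ' e zs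
        same-members e _ = T-ext (λ t → T-mem e zs (f e (mem-T e ys t))) (λ t → T-mem e ys (g e (mem-T e zs t)))

      unique-once : ∀ {xs : List A} {a} → Unique xs → a ∈ xs → Once xs a
      unique-once {x ∷ xs} {a} u (here refl) = trans (cong (_+ ∑ xs (λ y → δ y x)) (δ-refl x)) (cong suc (trans (∑-cong xs (λ y my → δ-≢ (λ e → unique-∉ u (subst (_∈ xs) e my)))) (∑-0 xs)))
      unique-once {x ∷ xs} {a} u (there m) = trans (cong (_+ ∑ xs (λ y → δ y a)) (δ-≢ (λ e → unique-∉ u (subst (_∈ xs) (sym e) m)))) (unique-once (unique-tail u) m)

    module SubOnce (_≟_ : DecidableEquality A) where
      _≟L_ : DecidableEquality (List A)
      _≟L_ = ListP.≡-dec _≟_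
      open DecEq _≟L_

      sublists-once : ∀ {xs b} → Unique xs → b ∈ sublists xs → Once (sublists xs) b
      sublists-once {[]} u (here refl) = refl
      sublists-once {x ∷ xs} {b} u m with ∈sublists-∷ {x = x} {xs = xs} m
      ... | inj₁ (zs , refl , mz) =
        trans (∑-++ (map (x ∷_) (sublists xs)) (sublists xs) (λ c → δ c (x ∷ zs)))
        (trans (cong₂ _+_ (trans (∑-map (x ∷_) (sublists xs) (λ c → δ c (x ∷ zs)))
                                (trans (∑-cong (sublists xs) (λ c _ → δ-ext {x ∷ c} {x ∷ zs} {c} {zs} (λ e → ListP.∷-injectiveʳ e) (cong (x ∷_)))) (sublists-once (unique-tail u) mz)))
                          (trans (∑-cong (sublists xs) (λ c mc → δ-≢ (λ e → unique-∉ u (sublist-⊆ mc (subst (x ∈_) (sym e) (here refl)))))) (∑-0 (sublists xs))))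
         refl)
      ... | inj₂ m2 =
        trans (∑-++ (map (x ∷_) (sublists xs)) (sublists xs) (λ c → δ c b))
        (cong₂ _+_ (trans (∑-map (x ∷_) (sublists xs) (λ c → δ c b))
                     (trans (∑-cong (sublists xs) (λ c _ → δ-≢ (λ e → unique-∉ u (sublist-⊆ m2 (subst (x ∈_) e (here refl)))))) (∑-0 (sublists xs))))
                   (sublists-once (unique-tail u) m2))

  max-≤ : ∀ ns n → n ∈ ns → n ≤ maximum ns
  max-≤ (m ∷ ns) n (here refl) = m≤m⊔n n (maximum ns)
  max-≤ (m ∷ ns) n (there h) = ≤-trans (max-≤ ns n h) (m≤n⊔m m (maximum ns))

  max-attained : ∀ ns → maximum ns ≡ 0 ⊎ maximum ns ∈ ns
  max-attained [] = inj₁ refl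
  max-attained (m ∷ ns) with ⊔-sel m (maximum ns)
  ... | inj₁ e = inj₂ (subst (_∈ m ∷ ns) (sym e) (here refl))
  ... | inj₂ e with max-attained ns
  ...   | inj₁ z = inj₁ (trans e z)
  ...   | inj₂ h = inj₂ (subst (_∈ m ∷ ns) (sym e) (there h))

  module _ {A : Set} where
    ∑-allVecs-suc : ∀ (xs : List A) n (f : Vec A (suc n) → ℕ) → ∑ (allVecs xs (suc n)) f ≡ ∑ xs (λ x → ∑ (allVecs xs n) (λ v → f (x ∷ v)))
    ∑-allVecs-suc xs n f = trans (∑-concatMap (λ x → map (x ∷_) (allVecs xs n)) xs f) (∑-cong xs (λ x _ → ∑-map (x ∷_) (allVecs xs n) f))

    ∑-const : ∀ (xs : List A) c → ∑ xs (λ _ → c) ≡ length xs * c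
    ∑-const [] c = refl
    ∑-const (x ∷ xs) c = cong (c +_) (∑-const xs c)

    length-allVecs : ∀ (xs : List A) n → length (allVecs xs n) ≡ length xs ^ n
    length-allVecs xs zero = refl
    length-allVecs xs (suc n) = trans (sym (∑-1≡length (allVecs xs (suc n))))
       (trans (∑-allVecs-suc xs n (λ _ → 1))
       (trans (∑-cong xs (λ x _ → trans (∑-1≡length (allVecs xs n)) (length-allVecs xs n)))
       (∑-const xs (length xs ^ n))))

    count-all-tuples : ∀ (xs : List A) (p : A → Bool) t → ∑ (allVecs xs t) (λ τ → 𝟙 (all p (toList τ))) ≡ ∑ xs (λ x → 𝟙 (p x)) ^ t
    count-all-tuples xs p zero = refl
    count-all-tuples xs p (suc t) =
      trans (∑-allVecs-suc xs t (λ τ → 𝟙 (all p (toList τ))))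
      (trans (∑-cong xs (λ x _ → trans (∑-cong (allVecs xs t) (λ v _ → 𝟙-∧ (p x) (all p (toList v)))) (∑-*ˡ (allVecs xs t) (𝟙 (p x)) (λ v → 𝟙 (all p (toList v))))))
      (trans (∑-*ʳ xs _ (λ x → 𝟙 (p x))) (cong (∑ xs (λ x → 𝟙 (p x)) *_) (count-all-tuples xs p t))))

    module VecDec (_≟_ : DecidableEquality A) where
      _≟V_ : ∀ {n} → DecidableEquality (Vec A n)
      _≟V_ = VecP.≡-dec _≟_
      module DA = DecEq _≟_
      module DV {n} = DecEq (_≟V_ {n})

      allVecs-once : ∀ (xs : List A) → (∀ a → DA.Once xs a) → ∀ n (v : Vec A n) → DV.Once (allVecs xs n) v
      allVecs-once xs o zero [] = refl
      allVecs-once xs o (suc n) (a ∷ v) =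
        trans (∑-allVecs-suc xs n (λ w → DV.δ w (a ∷ v)))
        (trans (∑-cong xs (λ x _ → trans (∑-cong (allVecs xs n) (λ w _ → δ-∷ x w)) (trans (∑-*ˡ (allVecs xs n) (DA.δ x a) (λ w → DV.δ w v)) (cong (DA.δ x a *_) (allVecs-once xs o n v)))))
        (trans (∑-cong xs (λ x _ → *-identityʳ (DA.δ x a))) (o a)))
        where
        δ-∷ : ∀ x w → DV.δ (x ∷ w) (a ∷ v) ≡ DA.δ x a * DV.δ w v
        δ-∷ x w with x ≟ a | (_≟V_ {n}) w v | (_≟V_ {suc n}) (x ∷ w) (a ∷ v)
        ... | yes refl | yes refl | yes _ = refl
        ... | yes refl | yes refl | no ne = ⊥-elim (ne refl)
        ... | yes _ | no ne | yes e = ⊥-elim (ne (VecP.∷-injectiveʳ e))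
        ... | yes _ | no _ | no _ = refl
        ... | no ne | _ | yes e = ⊥-elim (ne (VecP.∷-injectiveˡ e))
        ... | no _ | _ | no _ = refl

  module _ {A : Set} where
    filterᵇ-∈⁺ : ∀ (p : A → Bool) {x xs} → x ∈ xs → T (p x) → x ∈ filterᵇ p xs
    filterᵇ-∈⁺ p = ∈-filter⁺ (T? ∘ p)

    filterᵇ-∈⁻ : ∀ (p : A → Bool) {x xs} → x ∈ filterᵇ p xs → x ∈ xs × T (p x)
    filterᵇ-∈⁻ p = ∈-filter⁻ (T? ∘ p)

    ∈-split : ∀ {u w : A} pre post → u ∈ pre ++ w ∷ post → u ≡ w ⊎ u ∈ pre ++ post
    ∈-split [] post (here refl) = inj₁ refl
    ∈-split [] post (there m) = inj₂ m
    ∈-split (x ∷ pre) post (here refl) = inj₂ (here refl)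
    ∈-split (x ∷ pre) post (there m) with ∈-split pre post m
    ... | inj₁ e = inj₁ e
    ... | inj₂ m' = inj₂ (there m')

    ∈-unsplit : ∀ {u w : A} pre post → u ∈ pre ++ post → u ∈ pre ++ w ∷ post
    ∈-unsplit [] post m = there m
    ∈-unsplit (x ∷ pre) post (here refl) = here refl
    ∈-unsplit (x ∷ pre) post (there m) = there (∈-unsplit pre post m)

    ∈-mid : ∀ {w : A} pre post → w ∈ pre ++ w ∷ post
    ∈-mid [] post = here refl
    ∈-mid (x ∷ pre) post = there (∈-mid pre post)

    split-at-length : ∀ (cs : List A) m n → length cs ≡ m + n → ∃₂ λ cs1 cs2 → cs ≡ cs1 ++ cs2 × length cs1 ≡ m × length cs2 ≡ n
    split-at-length cs zero n e = [] , cs , refl , refl , e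
    split-at-length (c ∷ cs) (suc m) n e with split-at-length cs m n (suc-injective e)
    ... | cs1 , cs2 , refl , e1 , e2 = c ∷ cs1 , cs2 , refl , cong suc e1 , e2

    All-tab : ∀ {P : A → Set} xs → (∀ x → x ∈ xs → P x) → All P xs
    All-tab xs f = All.tabulate (f _)

  module _ {A : Set} (_≟_ : DecidableEquality A) where
    open DecEq _≟_
    atmost-unique : ∀ (xs : List A) → (∀ a → ∑ xs (λ x → δ x a) ≤ 1) → Unique xs
    atmost-unique [] h = []
    atmost-unique (x ∷ xs) h = All-tab xs no-repeat ∷ atmost-unique xs (λ a → ≤-trans (m≤n+m _ (δ x a)) (h a))
      where
      no-repeat : ∀ y → y ∈ xs → x ≢ y
      no-repeat y my refl = 1+n≰n (≤-trans (+-monoʳ-≤ 1 (subst (_≤ ∑ xs (λ z → δ z x)) (δ-refl x) (∑-term xs (λ z → δ z x) x my))) (subst (λ z → z + ∑ xs (λ z → δ z x) ≤ 1) (δ-refl x) (h x)))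

    once-unique : ∀ (xs : List A) → (∀ a → Once xs a) → Unique xs
    once-unique xs o = atmost-unique xs (λ a → ≤-reflexive (o a))

module FieldVectors (F : Field) where

  open import Algebra.Bundles using (CommutativeRing)
  open import Data.Nat using (zero; suc)
  open import Data.Nat.Properties using (suc-injective)
  import Data.Vec.Properties as VecP
  open import Data.List using (List; []; _∷_; map; _++_; length)
  open import Data.List.Relation.Unary.All using (All; []; _∷_)
  open import Data.Vec using (Vec; []; _∷_; zipWith; toList)
  import Data.Vec as Vec
  open import Relation.Nullary using (¬_)
  open import Relation.Binary.PropositionalEquality
  open Field F
  open VecOps F

  commutativeRing : CommutativeRing _ _
  commutativeRing = record { isCommutativeRing = isCommutativeRing }
  open CommutativeRing commutativeRing public using (+-assoc; +-comm; +-identityˡ; +-identityʳ; -‿inverseˡ; -‿inverseʳ; *-assoc; *-comm; *-identityˡ; *-identityʳ; distribˡ; distribʳ; zeroˡ; zeroʳ)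
  open import Algebra.Properties.Ring (CommutativeRing.ring commutativeRing) public using (-‿distribˡ-*; -‿involutive; -1*x≈-x)
  open import Algebra.Properties.Group (CommutativeRing.+-group commutativeRing) using (inverseˡ-unique)
  open import Algebra.Properties.CommutativeSemigroup (CommutativeRing.+-commutativeSemigroup commutativeRing) public using (interchange)

  open ≡-Reasoning

  +≡0⇒≡- : ∀ {a b} → (a + b) ≡ 0# → a ≡ (- b)
  +≡0⇒≡- {a} {b} = inverseˡ-unique a b

  x+x≡x⇒x≡0 : ∀ {x} → (x + x) ≡ x → x ≡ 0#
  x+x≡x⇒x≡0 {x} h = begin
    x ≡⟨ sym (+-identityʳ x) ⟩
    x + 0# ≡⟨ cong (x +_) (sym (-‿inverseʳ x)) ⟩
    x + (x + (- x)) ≡⟨ sym (+-assoc x x (- x)) ⟩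
    (x + x) + (- x) ≡⟨ cong (_+ (- x)) h ⟩
    x + (- x) ≡⟨ -‿inverseʳ x ⟩
    0# ∎

  1≢0 : ¬ (1# ≡ 0#)
  1≢0 e = 0≢1 (sym e)

  +V-comm : ∀ {n} (u v : Vec Carrier n) → (u +V v) ≡ (v +V u)
  +V-comm [] [] = refl
  +V-comm (a ∷ u) (b ∷ v) = cong₂ _∷_ (+-comm a b) (+V-comm u v)

  +V-assoc : ∀ {n} (u v w : Vec Carrier n) → ((u +V v) +V w) ≡ (u +V (v +V w))
  +V-assoc [] [] [] = refl
  +V-assoc (a ∷ u) (b ∷ v) (c ∷ w) = cong₂ _∷_ (+-assoc a b c) (+V-assoc u v w)

  +V-interchange : ∀ {n} (a b c d : Vec Carrier n) → ((a +V b) +V (c +V d)) ≡ ((a +V c) +V (b +V d))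
  +V-interchange [] [] [] [] = refl
  +V-interchange (a ∷ as) (b ∷ bs) (c ∷ cs) (d ∷ ds) = cong₂ _∷_ (interchange a b c d) (+V-interchange as bs cs ds)

  +V-idˡ : ∀ {n} (v : Vec Carrier n) → (zeroV +V v) ≡ v
  +V-idˡ [] = refl
  +V-idˡ (a ∷ v) = cong₂ _∷_ (+-identityˡ a) (+V-idˡ v)

  +V-idʳ : ∀ {n} (v : Vec Carrier n) → (v +V zeroV) ≡ v
  +V-idʳ v = trans (+V-comm v zeroV) (+V-idˡ v)

  ·V-+V : ∀ {n} c (u v : Vec Carrier n) → (c ·V (u +V v)) ≡ ((c ·V u) +V (c ·V v))
  ·V-+V c [] [] = refl
  ·V-+V c (a ∷ u) (b ∷ v) = cong₂ _∷_ (distribˡ c a b) (·V-+V c u v)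

  +-·V : ∀ {n} a b (u : Vec Carrier n) → ((a + b) ·V u) ≡ ((a ·V u) +V (b ·V u))
  +-·V a b [] = refl
  +-·V a b (x ∷ u) = cong₂ _∷_ (distribʳ x a b) (+-·V a b u)

  *-·V : ∀ {n} a b (u : Vec Carrier n) → ((a * b) ·V u) ≡ (a ·V (b ·V u))
  *-·V a b [] = refl
  *-·V a b (x ∷ u) = cong₂ _∷_ (*-assoc a b x) (*-·V a b u)

  0·V : ∀ {n} (u : Vec Carrier n) → (0# ·V u) ≡ zeroV
  0·V [] = refl
  0·V (x ∷ u) = cong₂ _∷_ (zeroˡ x) (0·V u)

  ·V0 : ∀ {n} c → (c ·V zeroV {n}) ≡ zeroV
  ·V0 {zero} c = refl
  ·V0 {suc n} c = cong₂ _∷_ (zeroʳ c) (·V0 c)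

  1·V : ∀ {n} (u : Vec Carrier n) → (1# ·V u) ≡ u
  1·V [] = refl
  1·V (x ∷ u) = cong₂ _∷_ (*-identityˡ x) (1·V u)

  +V-neg : ∀ {n} (u : Vec Carrier n) → (u +V ((- 1#) ·V u)) ≡ zeroV
  +V-neg [] = refl
  +V-neg (x ∷ u) = cong₂ _∷_ (trans (cong (x +_) (-1*x≈-x x)) (-‿inverseʳ x)) (+V-neg u)

  +V≡0⇒≡-1·V : ∀ {n} (u v : Vec Carrier n) → (u +V v) ≡ zeroV → u ≡ ((- 1#) ·V v)
  +V≡0⇒≡-1·V [] [] h = refl
  +V≡0⇒≡-1·V (a ∷ u) (b ∷ v) h = cong₂ _∷_ (trans (+≡0⇒≡- (VecP.∷-injectiveˡ h)) (sym (-1*x≈-x b))) (+V≡0⇒≡-1·V u v (VecP.∷-injectiveʳ h))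

  dot-+ˡ : ∀ {n} (u v w : Vec Carrier n) → dot (u +V v) w ≡ (dot u w + dot v w)
  dot-+ˡ [] [] [] = sym (+-identityˡ 0#)
  dot-+ˡ (a ∷ u) (b ∷ v) (c ∷ w) rewrite dot-+ˡ u v w =
    trans (cong (_+ (dot u w + dot v w)) (distribʳ c a b)) (interchange (a * c) (b * c) (dot u w) (dot v w))

  dot-·ˡ : ∀ {n} c (u w : Vec Carrier n) → dot (c ·V u) w ≡ (c * dot u w)
  dot-·ˡ c [] [] = sym (zeroʳ c)
  dot-·ˡ c (a ∷ u) (b ∷ w) rewrite dot-·ˡ c u w = trans (cong (_+ (c * dot u w)) (*-assoc c a b)) (sym (distribˡ c (a * b) (dot u w)))

  dot-0ˡ : ∀ {n} (w : Vec Carrier n) → dot zeroV w ≡ 0#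
  dot-0ˡ [] = refl
  dot-0ˡ (b ∷ w) rewrite dot-0ˡ w = trans (+-identityʳ (0# * b)) (zeroˡ b)

  dot-comm : ∀ {n} (u w : Vec Carrier n) → dot u w ≡ dot w u
  dot-comm [] [] = refl
  dot-comm (a ∷ u) (b ∷ w) = cong₂ _+_ (*-comm a b) (dot-comm u w)

  dot-+ʳ : ∀ {n} (u v w : Vec Carrier n) → dot w (u +V v) ≡ (dot w u + dot w v)
  dot-+ʳ u v w = trans (dot-comm w (u +V v)) (trans (dot-+ˡ u v w) (cong₂ _+_ (dot-comm u w) (dot-comm v w)))

  dot-·ʳ : ∀ {n} c (u w : Vec Carrier n) → dot w (c ·V u) ≡ (c * dot w u)
  dot-·ʳ c u w = trans (dot-comm w (c ·V u)) (trans (dot-·ˡ c u w) (cong (c *_) (dot-comm u w)))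

  dot-0ʳ : ∀ {n} (w : Vec Carrier n) → dot w zeroV ≡ 0#
  dot-0ʳ w = trans (dot-comm w zeroV) (dot-0ˡ w)

  lincomb-++ : ∀ {n} (cs ds : List Carrier) (us vs : List (Vec Carrier n)) → length cs ≡ length us →
               lincomb (cs ++ ds) (us ++ vs) ≡ (lincomb cs us +V lincomb ds vs)
  lincomb-++ [] ds [] vs e = sym (+V-idˡ (lincomb ds vs))
  lincomb-++ (c ∷ cs) ds (u ∷ us) vs e rewrite lincomb-++ cs ds us vs (suc-injective e) = sym (+V-assoc (c ·V u) (lincomb cs us) (lincomb ds vs))

  lincomb-zero : ∀ {n} (cs : List Carrier) (vs : List (Vec Carrier n)) → All (_≡ 0#) cs → lincomb cs vs ≡ zeroV
  lincomb-zero [] [] _ = refl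
  lincomb-zero [] (v ∷ vs) _ = refl
  lincomb-zero (c ∷ cs) [] _ = refl
  lincomb-zero (c ∷ cs) (v ∷ vs) (refl ∷ h) rewrite lincomb-zero cs vs h | 0·V v = +V-idˡ zeroV

  lincomb-scale : ∀ {n} c (cs : List Carrier) (vs : List (Vec Carrier n)) → lincomb (map (c *_) cs) vs ≡ (c ·V lincomb cs vs)
  lincomb-scale c [] [] = sym (·V0 c)
  lincomb-scale c [] (v ∷ vs) = sym (·V0 c)
  lincomb-scale c (a ∷ cs) [] = sym (·V0 c)
  lincomb-scale c (a ∷ cs) (v ∷ vs) rewrite lincomb-scale c cs vs | *-·V c a v = sym (·V-+V c (a ·V v) (lincomb cs vs))

  dot-lincombʳ : ∀ {n} (u : Vec Carrier n) (cs : List Carrier) (vs : List (Vec Carrier n)) → All (λ v → dot u v ≡ 0#) vs → dot u (lincomb cs vs) ≡ 0#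
  dot-lincombʳ u [] [] _ = dot-0ʳ u
  dot-lincombʳ u [] (v ∷ vs) _ = dot-0ʳ u
  dot-lincombʳ u (c ∷ cs) [] _ = dot-0ʳ u
  dot-lincombʳ u (c ∷ cs) (v ∷ vs) (h ∷ hs) rewrite dot-+ʳ (c ·V v) (lincomb cs vs) u | dot-·ʳ c v u | h | dot-lincombʳ u cs vs hs = trans (+-identityʳ (c * 0#)) (zeroʳ c)

  dot-lincombˡ : ∀ {n} (u : Vec Carrier n) (cs : List Carrier) (vs : List (Vec Carrier n)) → All (λ v → dot v u ≡ 0#) vs → dot (lincomb cs vs) u ≡ 0#
  dot-lincombˡ u cs vs h = trans (dot-comm (lincomb cs vs) u) (dot-lincombʳ u cs vs (All-map h))
    where
    All-map : ∀ {ws : List (Vec Carrier _)} → All (λ v → dot v u ≡ 0#) ws → All (λ v → dot u v ≡ 0#) ws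
    All-map [] = []
    All-map {w ∷ _} (p ∷ ps) = trans (dot-comm u w) p ∷ All-map ps

  zeroV-entries : ∀ n → All (_≡ 0#) (toList (zeroV {n}))
  zeroV-entries zero = []
  zeroV-entries (suc n) = refl ∷ zeroV-entries n

  +V-cancel-zeroV : ∀ {n} (x v : Vec Carrier n) → (x +V v) ≡ v → x ≡ zeroV
  +V-cancel-zeroV x v e = begin
    x                                 ≡⟨ sym (+V-idʳ x) ⟩
    x +V zeroV                        ≡⟨ cong (x +V_) (sym (+V-neg v)) ⟩
    x +V (v +V ((- 1#) ·V v))         ≡⟨ sym (+V-assoc x v _) ⟩
    (x +V v) +V ((- 1#) ·V v)         ≡⟨ cong (_+V ((- 1#) ·V v)) e ⟩
    v +V ((- 1#) ·V v)                ≡⟨ +V-neg v ⟩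
    zeroV ∎

  lincomb-zip : ∀ {n m} e (cs ds : Vec Carrier m) (vs : List (Vec Carrier n)) →
    lincomb (toList (zipWith (λ a b → a + (e * b)) cs ds)) vs ≡ (lincomb (toList cs) vs +V (e ·V lincomb (toList ds) vs))
  lincomb-zip e [] [] vs = sym (trans (cong (zeroV +V_) (·V0 e)) (+V-idˡ zeroV))
  lincomb-zip e (c ∷ cs) (d ∷ ds) [] = sym (trans (cong (zeroV +V_) (·V0 e)) (+V-idˡ zeroV))
  lincomb-zip e (c ∷ cs) (d ∷ ds) (v ∷ vs) rewrite lincomb-zip e cs ds vs = begin
    ((c + (e * d)) ·V v) +V (L1 +V (e ·V L2))           ≡⟨ cong (_+V (L1 +V (e ·V L2))) (trans (+-·V c (e * d) v) (cong ((c ·V v) +V_) (*-·V e d v))) ⟩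
    ((c ·V v) +V (e ·V (d ·V v))) +V (L1 +V (e ·V L2)) ≡⟨ +V-interchange (c ·V v) _ L1 _ ⟩
    ((c ·V v) +V L1) +V ((e ·V (d ·V v)) +V (e ·V L2)) ≡⟨ cong (((c ·V v) +V L1) +V_) (sym (·V-+V e (d ·V v) L2)) ⟩
    ((c ·V v) +V L1) +V (e ·V ((d ·V v) +V L2)) ∎
    where L1 = lincomb (toList cs) vs
          L2 = lincomb (toList ds) vs

  lincomb-+ : ∀ {n k} (cs ds : Vec Carrier k) (vs : List (Vec Carrier n)) →
    lincomb (toList (cs +V ds)) vs ≡ (lincomb (toList cs) vs +V lincomb (toList ds) vs)
  lincomb-+ cs ds vs = trans (cong (λ z → lincomb (toList z) vs) (+V-as-zip cs ds))
                             (trans (lincomb-zip 1# cs ds vs) (cong (lincomb (toList cs) vs +V_) (1·V _)))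
    where
    +V-as-zip : ∀ {k} (cs ds : Vec Carrier k) → (cs +V ds) ≡ zipWith (λ a b → a + (1# * b)) cs ds
    +V-as-zip [] [] = refl
    +V-as-zip (c ∷ cs) (d ∷ ds) = cong₂ _∷_ (cong (c +_) (sym (*-identityˡ d))) (+V-as-zip cs ds)

module FiniteLinearAlgebra (F : Field) (es : List (Field.Carrier F))
          (once : ∀ a → Counting.DecEq.Once (Field._≟_ F) es a) where

  open import Data.List using (List)

  open import Data.Bool using (Bool; true; false; T; _∧_; _∨_; not)
  open import Data.Nat using (ℕ; zero; suc; _≤_; _^_) renaming (_+_ to _+ℕ_; _*_ to _*ℕ_)
  import Data.Nat.Properties as ℕP
  open ℕP using (suc-injective; <-irrefl; ≤-trans)
  open import Data.List using (List; []; _∷_; map; _++_; length; filterᵇ; replicate)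
  import Data.List.Properties as ListP
  open import Data.Bool.ListAction using (all; any)
  open import Data.List.Membership.Propositional using (_∈_; _∉_)
  open import Data.List.Membership.Propositional.Properties using (∈-map⁺; ∈-map⁻; ∈-∃++)
  open import Data.List.Relation.Unary.Any using (here; there)
  open import Data.List.Relation.Unary.All using (All; []; _∷_)
  import Data.List.Relation.Unary.All as All
  import Data.List.Relation.Unary.All.Properties as AllP
  open import Data.Vec using (Vec; []; _∷_; toList; zipWith; head; tail)
  import Data.Vec as Vec
  import Data.Vec.Properties as VecP
  open import Data.Product using (Σ; _×_; _,_; proj₁; proj₂; ∃)
  open import Data.Sum using (inj₁; inj₂)
  open import Data.Empty using (⊥-elim)
  open import Data.Unit using (tt)
  open import Relation.Binary.PropositionalEquality
  open import Relation.Nullary using (¬_; yes; no)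
  open import Function using (_∘_; Equivalence)
  open import Data.Bool.Properties using (T-≡)
  open import Algebra.Properties.CommutativeSemigroup ℕP.*-commutativeSemigroup using (x∙yz≈y∙xz)
  open Counting
  open Enumeration

  open Field F
  open VecOps F
  open FieldVectors F

  module DF = DecEq {A = Carrier} _≟_
  open VecDec {A = Carrier} _≟_

  Q : ℕ
  Q = length es

  module _ {k : ℕ} where
    open Rank F es k public using (independentᵇ; rank)

  allVecs-once' : ∀ n (v : Vec Carrier n) → DV.Once (allVecs es n) v
  allVecs-once' = allVecs-once es once

  allVecs-∈ : ∀ n (v : Vec Carrier n) → v ∈ allVecs es n
  allVecs-∈ n v = DV.once-∈ (allVecs es n) v (allVecs-once' n v)

  count : ∀ k → (Vec Carrier k → Bool) → ℕ
  count k p = ∑ (allVecs es k) (λ c → 𝟙 (p c))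

  solᵇ : ∀ {k} → List (Vec Carrier k) → Vec Carrier k → Bool
  solᵇ vs c = all (λ v → isZeroᵇ (dot c v)) vs

  Independent : ∀ {k} → List (Vec Carrier k) → Set
  Independent ws = ∀ cs → length cs ≡ length ws → lincomb cs ws ≡ zeroV → All (_≡ 0#) cs

  InSpan : ∀ {k} → List (Vec Carrier k) → Vec Carrier k → Set
  InSpan ws v = ∃ λ cs → length cs ≡ length ws × lincomb cs ws ≡ v

  isZeroᵇ⇒≡0 : ∀ {x} → T (isZeroᵇ x) → x ≡ 0#
  isZeroᵇ⇒≡0 t = DF.T-δ t

  ≡0⇒isZeroᵇ : ∀ {x} → x ≡ 0# → T (isZeroᵇ x)
  ≡0⇒isZeroᵇ e = DF.δ-T e

  eqᵇ⇒≡ : ∀ {k} {u v : Vec Carrier k} → T (eqᵇ u v) → u ≡ v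
  eqᵇ⇒≡ t = DV.T-δ t

  ≡⇒eqᵇ : ∀ {k} {u v : Vec Carrier k} → u ≡ v → T (eqᵇ u v)
  ≡⇒eqᵇ e = DV.δ-T e

  toVec : ∀ {A : Set} (cs : List A) {n} → length cs ≡ n → Σ (Vec A n) (λ v → toList v ≡ cs)
  toVec [] refl = [] , refl
  toVec (c ∷ cs) refl = let (v , e) = toVec cs refl in c ∷ v , cong (c ∷_) e

  independentᵇ⇒Independent : ∀ {k} (ws : List (Vec Carrier k)) → T (independentᵇ ws) → Independent ws
  independentᵇ⇒Independent ws t cs len z with toVec cs len
  ... | cv , refl with all-T _ (allVecs es (length ws)) t cv (allVecs-∈ _ cv)
  ... | h with eqᵇ (lincomb (toList cv) ws) zeroV in e
  ...   | false = ⊥-elim (subst T e (≡⇒eqᵇ z))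
  ...   | true = All-tab (toList cv) (λ x m → isZeroᵇ⇒≡0 (all-T isZeroᵇ (toList cv) h x m))

  Independent⇒independentᵇ : ∀ {k} (ws : List (Vec Carrier k)) → Independent ws → T (independentᵇ ws)
  Independent⇒independentᵇ ws indep = T-all _ (allVecs es (length ws)) checks
    where
    checks : ∀ cv → cv ∈ allVecs es (length ws) → T (not (eqᵇ (lincomb (toList cv) ws) zeroV) ∨ all isZeroᵇ (toList cv))
    checks cv _ with eqᵇ (lincomb (toList cv) ws) zeroV in e
    ... | false = tt
    ... | true = T-all isZeroᵇ (toList cv) (λ x m → ≡0⇒isZeroᵇ (All.lookup (indep (toList cv) (VecP.length-toList cv) (eqᵇ⇒≡ (subst T (sym e) tt))) m))

  replicate-zero : ∀ n → All (_≡ 0#) (replicate n 0#)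
  replicate-zero zero = []
  replicate-zero (suc n) = refl ∷ replicate-zero n

  ∈⇒InSpan : ∀ {k} {ws : List (Vec Carrier k)} {v} → v ∈ ws → InSpan ws v
  ∈⇒InSpan {ws = w ∷ ws} (here refl) = 1# ∷ replicate (length ws) 0# , cong suc (ListP.length-replicate (length ws)) ,
     trans (cong₂ _+V_ (1·V w) (lincomb-zero _ ws (replicate-zero (length ws)))) (+V-idʳ w)
  ∈⇒InSpan {ws = w ∷ ws} (there m) with ∈⇒InSpan m
  ... | cs , len , e = 0# ∷ cs , cong suc len , trans (cong₂ _+V_ (0·V w) e) (+V-idˡ _)

  spanᵇ : ∀ {k} → List (Vec Carrier k) → Vec Carrier k → Bool
  spanᵇ ws v = any (λ cs → eqᵇ (lincomb (toList cs) ws) v) (allVecs es (length ws))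

  spanᵇ-T : ∀ {k} (ws : List (Vec Carrier k)) v → T (spanᵇ ws v) → InSpan ws v
  spanᵇ-T ws v t with any-T _ (allVecs es (length ws)) t
  ... | cv , _ , e = toList cv , VecP.length-toList cv , eqᵇ⇒≡ e

  T-spanᵇ : ∀ {k} (ws : List (Vec Carrier k)) v → InSpan ws v → T (spanᵇ ws v)
  T-spanᵇ ws v (cs , len , e) with toVec cs len
  ... | cv , refl = T-any _ (allVecs es (length ws)) cv (allVecs-∈ _ cv) (≡⇒eqᵇ e)

  indep-insert : ∀ {k} (pre post : List (Vec Carrier k)) v → Independent (pre ++ post) → ¬ InSpan (pre ++ post) v → Independent (pre ++ v ∷ post)
  indep-insert pre post v indep v∉span cs len z
    with split-at-length cs (length pre) (suc (length post)) (trans len (ListP.length-++ pre))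
  ... | cs1 , [] , refl , e1 , ()
  ... | cs1 , c ∷ cs2 , refl , e1 , e2 with c ≟ 0#
  ...   | yes refl = AllP.++⁺ (proj₁ coefficients-zero) (refl ∷ proj₂ coefficients-zero)
    where
    L1 = lincomb cs1 pre
    L2 = lincomb cs2 post
    dependency-without-v : lincomb (cs1 ++ cs2) (pre ++ post) ≡ zeroV
    dependency-without-v = trans (lincomb-++ cs1 cs2 pre post e1)
         (trans (cong (L1 +V_) (sym (trans (cong (_+V L2) (0·V v)) (+V-idˡ L2))))
         (trans (sym (lincomb-++ cs1 (0# ∷ cs2) pre (v ∷ post) e1)) z))
    coefficients-zero = AllP.++⁻ cs1 (indep (cs1 ++ cs2) (trans (ListP.length-++ cs1) (trans (cong₂ _+ℕ_ e1 (suc-injective e2)) (sym (ListP.length-++ pre)))) dependency-without-v)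
  ...   | no nz = ⊥-elim (v∉span (map ((- c⁻¹) *_) (cs1 ++ cs2) , trans (ListP.length-map _ (cs1 ++ cs2)) (trans (ListP.length-++ cs1) (trans (cong₂ _+ℕ_ e1 (suc-injective e2)) (sym (ListP.length-++ pre)))) , X-spans-v))
    where
    c⁻¹ = proj₁ (inverse c nz)
    cc⁻¹≡1 : (c * c⁻¹) ≡ 1#
    cc⁻¹≡1 = proj₂ (inverse c nz)
    L1 = lincomb cs1 pre
    L2 = lincomb cs2 post
    X = L1 +V L2
    dependency : (L1 +V ((c ·V v) +V L2)) ≡ zeroV
    dependency = trans (sym (lincomb-++ cs1 (c ∷ cs2) pre (v ∷ post) e1)) z
    cv+X≡0 : ((c ·V v) +V X) ≡ zeroV
    cv+X≡0 = trans (sym (+V-assoc (c ·V v) L1 L2)) (trans (cong (_+V L2) (+V-comm (c ·V v) L1)) (trans (+V-assoc L1 (c ·V v) L2) dependency))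
    cv≡-X : (c ·V v) ≡ ((- 1#) ·V X)
    cv≡-X = +V≡0⇒≡-1·V (c ·V v) X cv+X≡0
    X-spans-v : lincomb (map ((- c⁻¹) *_) (cs1 ++ cs2)) (pre ++ post) ≡ v
    X-spans-v = begin
      lincomb (map ((- c⁻¹) *_) (cs1 ++ cs2)) (pre ++ post) ≡⟨ lincomb-scale (- c⁻¹) (cs1 ++ cs2) (pre ++ post) ⟩
      (- c⁻¹) ·V lincomb (cs1 ++ cs2) (pre ++ post) ≡⟨ cong ((- c⁻¹) ·V_) (lincomb-++ cs1 cs2 pre post e1) ⟩
      (- c⁻¹) ·V X ≡⟨ cong (_·V X) (trans (sym (-1*x≈-x c⁻¹)) (*-comm (- 1#) c⁻¹)) ⟩
      (c⁻¹ * (- 1#)) ·V X ≡⟨ *-·V c⁻¹ (- 1#) X ⟩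
      c⁻¹ ·V ((- 1#) ·V X) ≡⟨ cong (c⁻¹ ·V_) (sym cv≡-X) ⟩
      c⁻¹ ·V (c ·V v) ≡⟨ sym (*-·V c⁻¹ c v) ⟩
      (c⁻¹ * c) ·V v ≡⟨ cong (_·V v) (trans (*-comm c⁻¹ c) cc⁻¹≡1) ⟩
      1# ·V v ≡⟨ 1·V v ⟩
      v ∎
      where open ≡-Reasoning

  -- A longest independent sublist spans: a vector outside its span could be inserted.
  maximal-independent-sublist : ∀ {k} (vs : List (Vec Carrier k)) →
    ∃ λ ws → ws ∈ sublists vs × Independent ws × length ws ≡ rank vs × (∀ v → v ∈ vs → InSpan ws v)
  maximal-independent-sublist {k} vs with longest
    where
    independentSublists = filterᵇ independentᵇ (sublists vs)
    longest : ∃ λ ws → ws ∈ sublists vs × Independent ws × length ws ≡ rank vs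
    longest with max-attained (map length independentSublists)
    ... | inj₁ z = [] , []∈sublists vs , (λ { [] _ _ → [] }) , sym z
    ... | inj₂ m with ∈-map⁻ length m
    ...   | ws , mf , e = let (ms , t) = filterᵇ-∈⁻ independentᵇ mf in ws , ms , independentᵇ⇒Independent ws t , sym e
  ... | ws , ms , iw , len = ws , ms , iw , len , spans
    where
    independentSublists = filterᵇ independentᵇ (sublists vs)
    spans : ∀ v → v ∈ vs → InSpan ws v
    spans v mv with T-dec (spanᵇ ws v)
    ... | inj₁ t = spanᵇ-T ws v t
    ... | inj₂ nt = ⊥-elim (<-irrefl refl (≤-trans longer-than-rank (ℕP.≤-reflexive (sym len))))
      where
      v∉span : ¬ InSpan ws v
      v∉span h = nt (T-spanᵇ ws v h)
      v∉ws : v ∉ ws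
      v∉ws m = v∉span (∈⇒InSpan m)
      insertion = sublist-insert ms mv v∉ws
      pre = proj₁ insertion
      post = proj₁ (proj₂ insertion)
      ws≡pre++post : ws ≡ pre ++ post
      ws≡pre++post = proj₁ (proj₂ (proj₂ insertion))
      insertion∈sublists : (pre ++ v ∷ post) ∈ sublists vs
      insertion∈sublists = proj₂ (proj₂ (proj₂ insertion))
      insertion-independent : Independent (pre ++ v ∷ post)
      insertion-independent = indep-insert pre post v (subst Independent ws≡pre++post iw) (subst (λ z → ¬ InSpan z v) ws≡pre++post v∉span)
      longer-than-rank : suc (length ws) ≤ rank vs
      longer-than-rank = subst (_≤ rank vs) (trans (ListP.length-++ pre) (trans (ℕP.+-suc _ _) (cong suc (trans (sym (ListP.length-++ pre)) (cong length (sym ws≡pre++post))))))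
                (max-≤ (map length independentSublists) _ (∈-map⁺ length (filterᵇ-∈⁺ independentᵇ insertion∈sublists (Independent⇒independentᵇ _ insertion-independent))))

  solᵇ-spanning-sublist : ∀ {k} (vs ws : List (Vec Carrier k)) → ws ∈ sublists vs → (∀ v → v ∈ vs → InSpan ws v) → ∀ c → solᵇ vs c ≡ solᵇ ws c
  solᵇ-spanning-sublist vs ws ms sp c = T-ext to from
    where
    to : T (solᵇ vs c) → T (solᵇ ws c)
    to t = T-all _ ws (λ w mw → all-T _ vs t w (sublist-⊆ ms mw))
    from : T (solᵇ ws c) → T (solᵇ vs c)
    from t = T-all _ vs (λ v mv → let (cs , _ , e) = sp v mv in
      ≡0⇒isZeroᵇ (subst (λ z → dot c z ≡ 0#) e (dot-lincombʳ c cs ws (All-tab ws (λ w mw → isZeroᵇ⇒≡0 (all-T _ ws t w mw))))))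

  tail-+V : ∀ {k} (u v : Vec Carrier (suc k)) → tail (u +V v) ≡ (tail u +V tail v)
  tail-+V (a ∷ u) (b ∷ v) = refl

  head-+V : ∀ {k} (u v : Vec Carrier (suc k)) → head (u +V v) ≡ (head u + head v)
  head-+V (a ∷ u) (b ∷ v) = refl

  lincomb-tail : ∀ {k} cs (ws : List (Vec Carrier (suc k))) → tail (lincomb cs ws) ≡ lincomb cs (map tail ws)
  lincomb-tail [] [] = refl
  lincomb-tail [] (w ∷ ws) = refl
  lincomb-tail (c ∷ cs) [] = refl
  lincomb-tail (c ∷ cs) ((a ∷ w) ∷ ws) = trans (tail-+V (c ·V (a ∷ w)) (lincomb cs ws)) (cong ((c ·V w) +V_) (lincomb-tail cs ws))

  lincomb-head : ∀ {k} cs (ws : List (Vec Carrier (suc k))) → All (λ w → head w ≡ 0#) ws → head (lincomb cs ws) ≡ 0#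
  lincomb-head [] [] _ = refl
  lincomb-head [] (w ∷ ws) _ = refl
  lincomb-head (c ∷ cs) [] _ = refl
  lincomb-head (c ∷ cs) ((a ∷ w) ∷ ws) (refl ∷ h) = trans (head-+V (c ·V (0# ∷ w)) (lincomb cs ws)) (trans (cong₂ _+_ (zeroʳ c) (lincomb-head cs ws h)) (+-identityˡ 0#))

  lincomb-head-zero : ∀ {k} cs (ws : List (Vec Carrier (suc k))) → All (λ w → head w ≡ 0#) ws → lincomb cs ws ≡ 0# ∷ lincomb cs (map tail ws)
  lincomb-head-zero cs ws h = trans (eta (lincomb cs ws)) (cong₂ _∷_ (lincomb-head cs ws h) (lincomb-tail cs ws))
    where eta : ∀ {k} (v : Vec Carrier (suc k)) → v ≡ head v ∷ tail v
          eta (x ∷ v) = refl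

  dot-head0 : ∀ {k} x c' (v : Vec Carrier (suc k)) → head v ≡ 0# → dot (x ∷ c') v ≡ dot c' (tail v)
  dot-head0 x c' (h ∷ v) refl = trans (cong (_+ dot c' v) (zeroʳ x)) (+-identityˡ _)

  solᵇ-no-pivot : ∀ k (ws : List (Vec Carrier (suc k))) → All (λ w → head w ≡ 0#) ws →
    (∀ x c' → solᵇ ws (x ∷ c') ≡ solᵇ (map tail ws) c')
  solᵇ-no-pivot k [] _ x c' = refl
  solᵇ-no-pivot k ((a ∷ w) ∷ ws) (refl ∷ h) x c' = cong₂ _∧_ (cong isZeroᵇ (trans (cong (_+ dot c' w) (zeroʳ x)) (+-identityˡ _))) (solᵇ-no-pivot k ws h x c')

  SolutionCount : ℕ → Set
  SolutionCount k = ∀ (ws : List (Vec Carrier k)) → Independent ws → count k (solᵇ ws) *ℕ Q ^ length ws ≡ Q ^ k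

  -- Eliminating with the pivot row w clears the first coordinate of the other rows; a solution
  -- then consists of a solution of the reduced system and the unique first coordinate orthogonal to w.
  module Pivot (k : ℕ) (pre post : List (Vec Carrier (suc k))) (a : Carrier) (w' : Vec Carrier k) (a≢0 : ¬ a ≡ 0#) where
    open ≡-Reasoning
    w : Vec Carrier (suc k)
    w = a ∷ w'
    ws = pre ++ w ∷ post
    rest = pre ++ post
    a⁻¹ : Carrier
    a⁻¹ = proj₁ (inverse a a≢0)
    aa⁻¹≡1 : (a * a⁻¹) ≡ 1#
    aa⁻¹≡1 = proj₂ (inverse a a≢0)
    factor : Vec Carrier (suc k) → Carrier
    factor u = head u * a⁻¹
    eliminate : Vec Carrier (suc k) → Vec Carrier (suc k)
    eliminate u = u +V ((- factor u) ·V w)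
    reduced : List (Vec Carrier k)
    reduced = map (tail ∘ eliminate) rest

    head-eliminate : ∀ u → head (eliminate u) ≡ 0#
    head-eliminate (h ∷ u) = begin
      h + ((- (h * a⁻¹)) * a) ≡⟨ cong (h +_) (sym (-‿distribˡ-* (h * a⁻¹) a)) ⟩
      h + (- ((h * a⁻¹) * a)) ≡⟨ cong (λ z → h + (- z)) (trans (*-assoc h a⁻¹ a) (trans (cong (h *_) (trans (*-comm a⁻¹ a) aa⁻¹≡1)) (*-identityʳ h))) ⟩
      h + (- h) ≡⟨ -‿inverseʳ h ⟩
      0# ∎

    dot-eliminate : ∀ c u → dot c (eliminate u) ≡ (dot c u + ((- factor u) * dot c w))
    dot-eliminate c u = trans (dot-+ʳ u ((- factor u) ·V w) c) (cong (dot c u +_) (dot-·ʳ (- factor u) w c))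

    pivot-weight : List Carrier → List (Vec Carrier (suc k)) → Carrier
    pivot-weight (c ∷ cs) (u ∷ us) = (c * (- factor u)) + pivot-weight cs us
    pivot-weight _ _ = 0#

    lincomb-eliminate : ∀ cs us → lincomb cs (map eliminate us) ≡ (lincomb cs us +V (pivot-weight cs us ·V w))
    lincomb-eliminate [] [] = sym (trans (cong (zeroV +V_) (0·V w)) (+V-idˡ zeroV))
    lincomb-eliminate [] (u ∷ us) = sym (trans (cong (zeroV +V_) (0·V w)) (+V-idˡ zeroV))
    lincomb-eliminate (c ∷ cs) [] = sym (trans (cong (zeroV +V_) (0·V w)) (+V-idˡ zeroV))
    lincomb-eliminate (c ∷ cs) (u ∷ us) rewrite lincomb-eliminate cs us = begin
      (c ·V (u +V (l ·V w))) +V (L +V (β ·V w))       ≡⟨ cong (_+V (L +V (β ·V w))) (trans (·V-+V c u (l ·V w)) (cong ((c ·V u) +V_) (sym (*-·V c l w)))) ⟩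
      ((c ·V u) +V ((c * l) ·V w)) +V (L +V (β ·V w)) ≡⟨ +V-interchange (c ·V u) _ L _ ⟩
      ((c ·V u) +V L) +V (((c * l) ·V w) +V (β ·V w)) ≡⟨ cong (((c ·V u) +V L) +V_) (sym (+-·V (c * l) β w)) ⟩
      ((c ·V u) +V L) +V (((c * l) + β) ·V w) ∎
      where l = - factor u
            L = lincomb cs us
            β = pivot-weight cs us

    length-reduced : length reduced ≡ length pre +ℕ length post
    length-reduced = trans (ListP.length-map _ rest) (ListP.length-++ pre)

    length-ws : length ws ≡ suc (length reduced)
    length-ws = trans (ListP.length-++ pre) (trans (ℕP.+-suc _ _) (cong suc (sym length-reduced)))

    reduced-independent : Independent ws → Independent reduced
    reduced-independent iw cs len z with split-at-length cs (length pre) (length post) (trans len length-reduced)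
    ... | cs1 , cs2 , refl , e1 , e2 = AllP.++⁺ (proj₁ coefficients-zero) (proj₂ coefficients-zero)
      where
      eliminated-dependency : lincomb (cs1 ++ cs2) (map eliminate rest) ≡ zeroV
      eliminated-dependency = trans (lincomb-head-zero (cs1 ++ cs2) (map eliminate rest) (All-tab _ (λ v mv → let (u , _ , e) = ∈-map⁻ eliminate mv in trans (cong head e) (head-eliminate u))))
                    (cong (0# ∷_) (trans (cong (lincomb (cs1 ++ cs2)) (sym (ListP.map-∘ rest))) z))
      β = pivot-weight (cs1 ++ cs2) rest
      L1 = lincomb cs1 pre
      L2 = lincomb cs2 post
      dependency : lincomb (cs1 ++ β ∷ cs2) ws ≡ zeroV
      dependency = begin
        lincomb (cs1 ++ β ∷ cs2) ws ≡⟨ lincomb-++ cs1 (β ∷ cs2) pre (w ∷ post) e1 ⟩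
        L1 +V ((β ·V w) +V L2) ≡⟨ cong (L1 +V_) (+V-comm (β ·V w) L2) ⟩
        L1 +V (L2 +V (β ·V w)) ≡⟨ sym (+V-assoc L1 L2 _) ⟩
        (L1 +V L2) +V (β ·V w) ≡⟨ cong (_+V (β ·V w)) (sym (lincomb-++ cs1 cs2 pre post e1)) ⟩
        lincomb (cs1 ++ cs2) rest +V (β ·V w) ≡⟨ sym (lincomb-eliminate (cs1 ++ cs2) rest) ⟩
        lincomb (cs1 ++ cs2) (map eliminate rest) ≡⟨ eliminated-dependency ⟩
        zeroV ∎
      coefficients-zero : All (_≡ 0#) cs1 × All (_≡ 0#) cs2
      coefficients-zero with AllP.++⁻ cs1 (iw (cs1 ++ β ∷ cs2) (trans (ListP.length-++ cs1) (trans (cong₂ _+ℕ_ e1 (cong suc e2)) (sym (ListP.length-++ pre)))) dependency)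
      ... | h1 , (_ ∷ h2) = h1 , h2

    solᵇ-pivot : ∀ x c' → solᵇ ws (x ∷ c') ≡ (isZeroᵇ (dot (x ∷ c') w) ∧ solᵇ reduced c')
    solᵇ-pivot x c' = T-ext to from
      where
      c = x ∷ c'
      to : T (solᵇ ws c) → T (isZeroᵇ (dot c w) ∧ solᵇ reduced c')
      to t = T-∧-intro (all-T _ ws t w (∈-mid pre post)) (T-all _ reduced reduced-row-orth)
        where
        c⊥w = isZeroᵇ⇒≡0 (all-T _ ws t w (∈-mid pre post))
        reduced-row-orth : ∀ v → v ∈ reduced → T (isZeroᵇ (dot c' v))
        reduced-row-orth v mv with ∈-map⁻ (tail ∘ eliminate) mv
        ... | u , mu , refl = ≡0⇒isZeroᵇ (begin
          dot c' (tail (eliminate u)) ≡⟨ sym (dot-head0 x c' (eliminate u) (head-eliminate u)) ⟩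
          dot c (eliminate u) ≡⟨ dot-eliminate c u ⟩
          dot c u + ((- factor u) * dot c w) ≡⟨ cong₂ (λ p q → p + ((- factor u) * q)) (isZeroᵇ⇒≡0 (all-T _ ws t u (∈-unsplit pre post mu))) c⊥w ⟩
          0# + ((- factor u) * 0#) ≡⟨ trans (+-identityˡ _) (zeroʳ _) ⟩
          0# ∎)
      from : T (isZeroᵇ (dot c w) ∧ solᵇ reduced c') → T (solᵇ ws c)
      from t = T-all _ ws row-orth
        where
        c⊥w = isZeroᵇ⇒≡0 (T-∧-l t)
        c'-solves = T-∧-r {isZeroᵇ (dot c w)} t
        row-orth : ∀ u → u ∈ ws → T (isZeroᵇ (dot c u))
        row-orth u mu with ∈-split pre post mu
        ... | inj₁ refl = ≡0⇒isZeroᵇ c⊥w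
        ... | inj₂ mr = ≡0⇒isZeroᵇ (begin
          dot c u ≡⟨ sym (+-identityʳ _) ⟩
          dot c u + 0# ≡⟨ cong (dot c u +_) (sym (trans (cong ((- factor u) *_) c⊥w) (zeroʳ _))) ⟩
          dot c u + ((- factor u) * dot c w) ≡⟨ sym (dot-eliminate c u) ⟩
          dot c (eliminate u) ≡⟨ dot-head0 x c' (eliminate u) (head-eliminate u) ⟩
          dot c' (tail (eliminate u)) ≡⟨ isZeroᵇ⇒≡0 (all-T _ reduced c'-solves (tail (eliminate u)) (∈-map⁺ (tail ∘ eliminate) mr)) ⟩
          0# ∎)

    unique-first-coordinate : ∀ d → ∑ es (λ x → 𝟙 (isZeroᵇ ((x * a) + d))) ≡ 1
    unique-first-coordinate d = DF.∑-𝟙-unique es (λ x → isZeroᵇ ((x * a) + d)) root (once root) (≡0⇒isZeroᵇ root-solves) root-unique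
      where
      root = (- d) * a⁻¹
      root-solves : ((root * a) + d) ≡ 0#
      root-solves = trans (cong (_+ d) (trans (*-assoc (- d) a⁻¹ a) (trans (cong ((- d) *_) (trans (*-comm a⁻¹ a) aa⁻¹≡1)) (*-identityʳ (- d))))) (-‿inverseˡ d)
      root-unique : ∀ x → T (isZeroᵇ ((x * a) + d)) → x ≡ root
      root-unique x t = begin
        x ≡⟨ sym (*-identityʳ x) ⟩
        x * 1# ≡⟨ cong (x *_) (sym aa⁻¹≡1) ⟩
        x * (a * a⁻¹) ≡⟨ sym (*-assoc x a a⁻¹) ⟩
        (x * a) * a⁻¹ ≡⟨ cong (_* a⁻¹) (+≡0⇒≡- (isZeroᵇ⇒≡0 t)) ⟩
        root ∎

    count-pivot : count (suc k) (solᵇ ws) ≡ count k (solᵇ reduced)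
    count-pivot = begin
      count (suc k) (solᵇ ws)
        ≡⟨ ∑-allVecs-suc es k _ ⟩
      ∑ es (λ x → ∑ (allVecs es k) (λ c' → 𝟙 (solᵇ ws (x ∷ c'))))
        ≡⟨ ∑-cong es (λ x _ → ∑-cong (allVecs es k) (λ c' _ → trans (cong 𝟙 (solᵇ-pivot x c')) (𝟙-∧ (isZeroᵇ (dot (x ∷ c') w)) (solᵇ reduced c')))) ⟩
      ∑ es (λ x → ∑ (allVecs es k) (λ c' → 𝟙 (isZeroᵇ ((x * a) + dot c' w')) *ℕ 𝟙 (solᵇ reduced c')))
        ≡⟨ ∑-swap es (allVecs es k) _ ⟩
      ∑ (allVecs es k) (λ c' → ∑ es (λ x → 𝟙 (isZeroᵇ ((x * a) + dot c' w')) *ℕ 𝟙 (solᵇ reduced c')))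
        ≡⟨ ∑-cong (allVecs es k) (λ c' _ → trans (∑-*ʳ es _ (λ x → 𝟙 (isZeroᵇ ((x * a) + dot c' w')))) (trans (cong (_*ℕ 𝟙 (solᵇ reduced c')) (unique-first-coordinate (dot c' w'))) (ℕP.*-identityˡ _))) ⟩
      count k (solᵇ reduced) ∎

    pivot-step : Independent ws → SolutionCount k → count (suc k) (solᵇ ws) *ℕ Q ^ length ws ≡ Q ^ suc k
    pivot-step iw IH = begin
      count (suc k) (solᵇ ws) *ℕ Q ^ length ws            ≡⟨ cong₂ (λ p e → p *ℕ Q ^ e) count-pivot length-ws ⟩
      count k (solᵇ reduced) *ℕ (Q *ℕ Q ^ length reduced) ≡⟨ x∙yz≈y∙xz (count k (solᵇ reduced)) Q (Q ^ length reduced) ⟩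
      Q *ℕ (count k (solᵇ reduced) *ℕ Q ^ length reduced) ≡⟨ cong (Q *ℕ_) (IH reduced (reduced-independent iw)) ⟩
      Q ^ suc k ∎

  no-pivot-step : ∀ k (ws : List (Vec Carrier (suc k))) → Independent ws → All (λ w → head w ≡ 0#) ws →
    SolutionCount k → count (suc k) (solᵇ ws) *ℕ Q ^ length ws ≡ Q ^ suc k
  no-pivot-step k ws iw heads-zero IH = begin
    count (suc k) (solᵇ ws) *ℕ Q ^ length ws              ≡⟨ cong₂ (λ p e → p *ℕ Q ^ e) count-tails (sym (ListP.length-map tail ws)) ⟩
    (Q *ℕ count k (solᵇ tails)) *ℕ Q ^ length tails       ≡⟨ ℕP.*-assoc Q _ _ ⟩
    Q *ℕ (count k (solᵇ tails) *ℕ Q ^ length tails)       ≡⟨ cong (Q *ℕ_) (IH tails tails-independent) ⟩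
    Q ^ suc k ∎
    where
    open ≡-Reasoning
    tails = map tail ws
    tails-independent : Independent tails
    tails-independent cs len z = iw cs (trans len (ListP.length-map tail ws)) (trans (lincomb-head-zero cs ws heads-zero) (cong (0# ∷_) z))
    count-tails : count (suc k) (solᵇ ws) ≡ Q *ℕ count k (solᵇ tails)
    count-tails = trans (∑-allVecs-suc es k _)
      (trans (∑-cong es (λ x _ → ∑-cong (allVecs es k) (λ c' _ → cong 𝟙 (solᵇ-no-pivot k ws heads-zero x c')))) (∑-const es _))

  count-solutions-independent : ∀ k → SolutionCount k
  count-solutions-independent zero [] _ = refl
  count-solutions-independent zero (w ∷ ws) iw with iw (1# ∷ replicate (length ws) 0#) (cong suc (ListP.length-replicate (length ws))) (empty _)
    where
    empty : (v : Vec Carrier 0) → v ≡ []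
    empty [] = refl
  ... | 1≡0 ∷ _ = ⊥-elim (1≢0 1≡0)
  count-solutions-independent (suc k) ws iw with T-dec (any (λ w → not (isZeroᵇ (head w))) ws)
  ... | inj₂ no-pivot = no-pivot-step k ws iw (All-tab ws heads-zero) (count-solutions-independent k)
    where
    heads-zero : ∀ w → w ∈ ws → head w ≡ 0#
    heads-zero w mw with isZeroᵇ (head w) in e
    ... | true = isZeroᵇ⇒≡0 (subst T (sym e) tt)
    ... | false = ⊥-elim (no-pivot (T-any _ ws w mw (subst (T ∘ not) (sym e) tt)))
  ... | inj₁ pivot with any-T _ ws pivot
  ...   | (a ∷ w') , mw , a≢0ᵇ with ∈-∃++ mw
  ...     | pre , post , refl = Pivot.pivot-step k pre post a w' a≢0 iw (count-solutions-independent k)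
    where
    a≢0 : a ≢ 0#
    a≢0 a≡0 = subst (T ∘ not) (Equivalence.to T-≡ (≡0⇒isZeroᵇ a≡0)) a≢0ᵇ

  count-solutions : ∀ k (vs : List (Vec Carrier k)) → count k (solᵇ vs) *ℕ Q ^ rank vs ≡ Q ^ k
  count-solutions k vs with maximal-independent-sublist vs
  ... | ws , ms , iw , len , sp = trans (cong₂ (λ p q → p *ℕ Q ^ q) (∑-cong (allVecs es k) (λ c _ → cong 𝟙 (solᵇ-spanning-sublist vs ws ms sp c))) (sym len)) (count-solutions-independent k ws iw)

  zipWith-sub≡0⇒≡ : ∀ {m} (cs ds : Vec Carrier m) → All (_≡ 0#) (toList (zipWith (λ a b → a + ((- 1#) * b)) cs ds)) → cs ≡ ds
  zipWith-sub≡0⇒≡ [] [] _ = refl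
  zipWith-sub≡0⇒≡ (c ∷ cs) (d ∷ ds) (h ∷ hs) = cong₂ _∷_ (trans (+≡0⇒≡- h) (trans (cong -_ (-1*x≈-x d)) (-‿involutive d))) (zipWith-sub≡0⇒≡ cs ds hs)

  lincomb-inj : ∀ {k} (ws : List (Vec Carrier k)) → Independent ws → (cs ds : Vec Carrier (length ws)) → lincomb (toList cs) ws ≡ lincomb (toList ds) ws → cs ≡ ds
  lincomb-inj ws iw cs ds e = zipWith-sub≡0⇒≡ cs ds (iw _ (VecP.length-toList (zipWith (λ a b → a + ((- 1#) * b)) cs ds)) difference-zero)
    where
    difference-zero : lincomb (toList (zipWith (λ a b → a + ((- 1#) * b)) cs ds)) ws ≡ zeroV
    difference-zero = trans (lincomb-zip (- 1#) cs ds ws) (trans (cong (λ X → lincomb (toList cs) ws +V ((- 1#) ·V X)) (sym e)) (+V-neg _))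

  count-span : ∀ k (ws : List (Vec Carrier k)) → Independent ws → count k (spanᵇ ws) ≡ Q ^ length ws
  count-span k ws iw = begin
    ∑ (allVecs es k) (λ x → 𝟙 (spanᵇ ws x))
      ≡⟨ ∑-cong (allVecs es k) (λ x _ → 𝟙-any _≟V_ (allVecs es (length ws)) (allVecs-once' _) _ (λ a b ta tb → lincomb-inj ws iw a b (trans (eqᵇ⇒≡ ta) (sym (eqᵇ⇒≡ tb))))) ⟩
    ∑ (allVecs es k) (λ x → ∑ (allVecs es (length ws)) (λ cs → DV.δ (lincomb (toList cs) ws) x))
      ≡⟨ ∑-swap (allVecs es k) (allVecs es (length ws)) _ ⟩
    ∑ (allVecs es (length ws)) (λ cs → ∑ (allVecs es k) (λ x → DV.δ (lincomb (toList cs) ws) x))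
      ≡⟨ ∑-cong (allVecs es (length ws)) (λ cs _ → trans (∑-cong (allVecs es k) (λ x _ → DV.δ-sym (lincomb (toList cs) ws) x)) (allVecs-once' k _)) ⟩
    ∑ (allVecs es (length ws)) (λ _ → 1)
      ≡⟨ ∑-1≡length (allVecs es (length ws)) ⟩
    length (allVecs es (length ws))
      ≡⟨ length-allVecs es (length ws) ⟩
    Q ^ length ws ∎
    where open ≡-Reasoning

module SubspaceFacts (K : FiniteField) (n : ℕ) where

  open import Data.Bool using (T; _∧_)
  import Data.Nat
  open import Data.Nat using (ℕ; _≤_; z≤n; s≤s; _^_) renaming (_+_ to _+ℕ_; _*_ to _*ℕ_)
  import Data.Nat.Properties as ℕP
  open import Data.List using (List; []; _∷_; length; filterᵇ; replicate)
  open import Data.List.Membership.Propositional using (_∈_)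
  open import Data.List.Relation.Unary.Any using (here; there)
  open import Data.List.Relation.Unary.All using ([]; _∷_)
  open import Data.List.Relation.Unary.Unique.Propositional using (Unique)
  open import Data.Vec using (Vec; []; _∷_; toList; zipWith)
  import Data.Vec as Vec
  import Data.Vec.Properties as VecP
  open import Data.Product using (_×_; _,_; proj₁; proj₂)
  open import Relation.Binary.PropositionalEquality
  open Counting
  open Enumeration

  open FiniteField K
  open Subspaces K n
  open VecOps field'
  open FieldVectors field'

  elems-once : ∀ a → DecEq.Once _≟_ elems a
  elems-once a = SubDec.unique-once _≟_ elems-unique (elems-complete a)

  open FiniteLinearAlgebra field' elems elems-once public
  open VecDec {A = Carrier} _≟_

  E-∈ : ∀ x → x ∈ E
  E-∈ x = allVecs-∈ n x

  mem-T : ∀ {x X} → T (memᵇ x X) → x ∈ X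
  mem-T {x} {X} t = DV.mem-T x X t

  T-mem : ∀ {x X} → x ∈ X → T (memᵇ x X)
  T-mem {x} {X} m = DV.T-mem x X m

  ⊆-T : ∀ {U V} → T (U ⊆ᵇ V) → ∀ x → x ∈ U → x ∈ V
  ⊆-T {U} {V} t x m = mem-T (all-T (λ y → memᵇ y V) U t x m)

  T-⊆ : ∀ {U V} → (∀ x → x ∈ U → x ∈ V) → T (U ⊆ᵇ V)
  T-⊆ {U} {V} f = T-all (λ y → memᵇ y V) U (λ x m → T-mem (f x m))

  orth-∈⁻ : ∀ {W x} → x ∈ orth W → T (solᵇ W x)
  orth-∈⁻ {W} {x} m = proj₂ (filterᵇ-∈⁻ (solᵇ W) {x} {E} m)

  orth-∈⁺ : ∀ {W x} → T (solᵇ W x) → x ∈ orth W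
  orth-∈⁺ {W} {x} t = filterᵇ-∈⁺ (solᵇ W) (E-∈ x) t

  sol-T : ∀ {W : List Vn} {x} → T (solᵇ W x) → ∀ w → w ∈ W → dot x w ≡ 0#
  sol-T {W} {x} t w m = isZeroᵇ⇒≡0 (all-T _ W t w m)

  T-sol : ∀ {W : List Vn} {x} → (∀ w → w ∈ W → dot x w ≡ 0#) → T (solᵇ W x)
  T-sol {W} {x} f = T-all _ W (λ w m → ≡0⇒isZeroᵇ (f w m))

  IsSubspace : List Vn → Set
  IsSubspace X = (zeroV ∈ X) × (∀ x y c → x ∈ X → y ∈ X → (x +V (c ·V y)) ∈ X)

  isSubspaceᵇ⇒IsSubspace : ∀ {X} → T (isSubspaceᵇ X) → IsSubspace X
  isSubspaceᵇ⇒IsSubspace {X} t = mem-T (T-∧-l t) , λ x y c mx my → mem-T (all-T _ elems (all-T _ X (all-T _ X (T-∧-r {memᵇ zeroV X} t) x mx) y my) c (elems-complete c))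

  IsSubspace⇒isSubspaceᵇ : ∀ {X} → IsSubspace X → T (isSubspaceᵇ X)
  IsSubspace⇒isSubspaceᵇ {X} (z , cl) = T-∧-intro (T-mem z) (T-all _ X (λ x mx → T-all _ X (λ y my → T-all _ elems (λ c _ → T-mem (cl x y c mx my)))))

  IsSubspace-lincomb : ∀ {X} → IsSubspace X → ∀ (vs : List Vn) → (∀ v → v ∈ vs → v ∈ X) → ∀ cs → lincomb cs vs ∈ X
  IsSubspace-lincomb (z , cl) [] h [] = z
  IsSubspace-lincomb (z , cl) [] h (c ∷ cs) = z
  IsSubspace-lincomb (z , cl) (v ∷ vs) h [] = z
  IsSubspace-lincomb {X} (z , cl) (v ∷ vs) h (c ∷ cs) =
    subst (_∈ X) (+V-comm (lincomb cs vs) (c ·V v)) (cl _ v c (IsSubspace-lincomb (z , cl) vs (λ u m → h u (there m)) cs) (h v (here refl)))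

  orth-IsSubspace : ∀ W → IsSubspace (orth W)
  orth-IsSubspace W = orth-∈⁺ {W} {zeroV} (T-sol {W} {zeroV} (λ w _ → dot-0ˡ w)) , closed
    where
    closed : ∀ x y c → x ∈ orth W → y ∈ orth W → (x +V (c ·V y)) ∈ orth W
    closed x y c mx my = orth-∈⁺ {W} {x +V (c ·V y)} (T-sol {W} {x +V (c ·V y)} (λ w mw →
      trans (dot-+ˡ x (c ·V y) w) (trans (cong₂ _+_ (sol-T {W} {x} (orth-∈⁻ {W} {x} mx) w mw)
        (trans (dot-·ˡ c y w) (trans (cong (c *_) (sol-T {W} {y} (orth-∈⁻ {W} {y} my) w mw)) (zeroʳ c)))) (+-identityˡ 0#))))

  span-IsSubspace : ∀ vs → IsSubspace (span vs)
  span-IsSubspace vs = zero∈span , closed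
    where
    InSpan⇒∈span : ∀ x → InSpan vs x → x ∈ span vs
    InSpan⇒∈span x h = filterᵇ-∈⁺ (spanᵇ vs) {x} {E} (E-∈ x) (T-spanᵇ vs x h)
    ∈span⇒InSpan : ∀ x → x ∈ span vs → InSpan vs x
    ∈span⇒InSpan x m = spanᵇ-T vs x (proj₂ (filterᵇ-∈⁻ (spanᵇ vs) {x} {E} m))
    zero∈span : zeroV ∈ span vs
    zero∈span = InSpan⇒∈span zeroV (toList (Vec.replicate (length vs) 0#) , VecP.length-toList (Vec.replicate (length vs) 0#) , lincomb-zero _ vs (zeroV-entries (length vs)))
    closed : ∀ x y c → x ∈ span vs → y ∈ span vs → (x +V (c ·V y)) ∈ span vs
    closed x y c mx my with ∈span⇒InSpan x mx | ∈span⇒InSpan y my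
    ... | cs , lc , ex | ds , ld , ey with toVec cs lc | toVec ds ld
    ... | cv , refl | dv , refl = InSpan⇒∈span _ (toList (zipWith (λ a b → a + (c * b)) cv dv) , VecP.length-toList (zipWith (λ a b → a + (c * b)) cv dv) ,
            trans (lincomb-zip c cv dv vs) (cong₂ (λ p q → p +V (c ·V q)) ex ey))

  open SubDec (VecDec._≟V_ _≟_ {n}) using (sublist-as-filter)

  E-unique : Unique E
  E-unique = once-unique (VecDec._≟V_ _≟_ {n}) E (allVecs-once' n)

  length-sublist : ∀ {W} → W ∈ sublists E → length W ≡ count n (λ e → memᵇ e W)
  length-sublist {W} m = trans (cong length (sublist-as-filter E-unique m)) (length-filter _ E)

  length-subspace : ∀ {W} → W ∈ sublists E → IsSubspace W → length W ≡ q ^ rank W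
  length-subspace {W} m cl with maximal-independent-sublist W
  ... | ws , ms , iw , len , sp =
    trans (length-sublist m) (trans (∑-cong E (λ e _ → cong 𝟙 (T-ext (λ t → T-spanᵇ ws e (sp e (mem-T t)))
          (λ t → let (cs , _ , ee) = spanᵇ-T ws e t in T-mem (subst (_∈ W) ee (IsSubspace-lincomb cl ws (λ v mv → sublist-⊆ ms mv) cs))))))
          (trans (count-span n ws iw) (cong (q ^_) len)))

  -- W ⊆ W⊥⊥, and both have q^n / |W⊥| elements.
  orth-orth⊆ : ∀ {W} → W ∈ sublists E → IsSubspace W → ∀ x → (∀ y → T (solᵇ W y) → dot x y ≡ 0#) → x ∈ W
  orth-orth⊆ {W} m cl x hx = mem-T (count-≡⇒converse E (λ e → memᵇ e W) (solᵇ W⊥) W⊆W⊥⊥ |W|≡|W⊥⊥| x (E-∈ x) (T-sol {W⊥} {x} (λ u mu → hx u (orth-∈⁻ {W} mu))))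
    where
    W⊥ = orth W
    W⊆W⊥⊥ : ∀ e → e ∈ E → T (memᵇ e W) → T (solᵇ W⊥ e)
    W⊆W⊥⊥ e _ t = T-sol {W⊥} {e} (λ u mu → trans (dot-comm e u) (sol-T {W} {u} (orth-∈⁻ {W} mu) e (mem-T t)))
    |W| = count n (λ e → memᵇ e W)
    |W⊥| = count n (solᵇ W)
    |W⊥⊥| = count n (solᵇ W⊥)
    length-W⊥ : length W⊥ ≡ |W⊥|
    length-W⊥ = length-filter (solᵇ W) E
    |W⊥|*|W| : |W⊥| *ℕ |W| ≡ q ^ n
    |W⊥|*|W| = trans (cong (|W⊥| *ℕ_) (trans (sym (length-sublist m)) (length-subspace m cl))) (count-solutions n W)
    |W⊥⊥|*|W⊥| : |W⊥⊥| *ℕ |W⊥| ≡ q ^ n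
    |W⊥⊥|*|W⊥| = trans (cong (|W⊥⊥| *ℕ_) (trans (sym length-W⊥) (length-subspace (filterᵇ∈sublists (solᵇ W) E) (orth-IsSubspace W)))) (count-solutions n W⊥)
    |W⊥|≥1 : 1 ≤ |W⊥|
    |W⊥|≥1 = subst (1 ≤_) length-W⊥ (nonempty W⊥ (proj₁ (orth-IsSubspace W)))
      where
      nonempty : ∀ (xs : List Vn) → zeroV ∈ xs → 1 ≤ length xs
      nonempty (_ ∷ _) _ = s≤s z≤n
    |W|≡|W⊥⊥| : |W| ≡ |W⊥⊥|
    |W|≡|W⊥⊥| = ℕP.*-cancelʳ-≡ |W| |W⊥⊥| |W⊥| {{Data.Nat.>-nonZero |W⊥|≥1}} (trans (ℕP.*-comm |W| |W⊥|) (trans |W⊥|*|W| (sym |W⊥⊥|*|W⊥|)))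

  ⊆ᵇ-refl : ∀ U → T (U ⊆ᵇ U)
  ⊆ᵇ-refl U = T-⊆ {U} {U} (λ _ h → h)

  ⊆ᵇ-trans : ∀ U V X → T (U ⊆ᵇ V) → T (V ⊆ᵇ X) → T (U ⊆ᵇ X)
  ⊆ᵇ-trans U V X p q = T-⊆ {U} {X} (λ z h → ⊆-T {V} {X} q z (⊆-T {U} {V} p z h))

  ⊆ᵇ-orth-flip : ∀ A B → T (A ⊆ᵇ orth B) → T (B ⊆ᵇ orth A)
  ⊆ᵇ-orth-flip A B h = T-⊆ {B} {orth A} (λ b mb → orth-∈⁺ {A} {b} (T-sol {A} {b} (λ a ma →
    trans (dot-comm b a) (sol-T {B} {a} (orth-∈⁻ {B} {a} (⊆-T {A} {orth B} h a ma)) b mb))))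

  ⊆ᵇ-orth-comm : ∀ A B → (A ⊆ᵇ orth B) ≡ (B ⊆ᵇ orth A)
  ⊆ᵇ-orth-comm A B = T-ext (⊆ᵇ-orth-flip A B) (⊆ᵇ-orth-flip B A)

  orth-⊆ᵇ-anti : ∀ A B → T (B ⊆ᵇ A) → T (orth A ⊆ᵇ orth B)
  orth-⊆ᵇ-anti A B h = T-⊆ {orth A} {orth B} (λ y my → orth-∈⁺ {B} {y} (T-sol {B} {y} (λ b mb →
    sol-T {A} {y} (orth-∈⁻ {A} {y} my) b (⊆-T {B} {A} h b mb))))

  orth-⊆ᵇ-reflect : ∀ A B → A ∈ sublists E → IsSubspace A → T (orth A ⊆ᵇ orth B) → T (B ⊆ᵇ A)
  orth-⊆ᵇ-reflect A B sa ca h = T-⊆ {B} {A} (λ b mb → orth-orth⊆ sa ca b (λ y ty →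
    sol-T {orth A} {b} (orth-∈⁻ {orth A} {b} (⊆-T {B} {orth (orth A)} B⊆A⊥⊥ b mb)) y (orth-∈⁺ {A} {y} ty)))
    where
    B⊆A⊥⊥ : T (B ⊆ᵇ orth (orth A))
    B⊆A⊥⊥ = ⊆ᵇ-orth-flip (orth A) B h

  subspaces⁻ : ∀ {V} → V ∈ subspaces → V ∈ sublists E × IsSubspace V
  subspaces⁻ {V} mV = let (mS , t) = filterᵇ-∈⁻ isSubspaceᵇ {V} {sublists E} mV in mS , isSubspaceᵇ⇒IsSubspace {V} t

  orth∈subspaces : ∀ A → orth A ∈ subspaces
  orth∈subspaces A = filterᵇ-∈⁺ isSubspaceᵇ (filterᵇ∈sublists _ E) (IsSubspace⇒isSubspaceᵇ {orth A} (orth-IsSubspace A))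

  span∈subspaces : ∀ vs → span vs ∈ subspaces
  span∈subspaces vs = filterᵇ-∈⁺ isSubspaceᵇ (filterᵇ∈sublists _ E) (IsSubspace⇒isSubspaceᵇ {span vs} (span-IsSubspace vs))

  sameᵇ-orth : ∀ A B → A ∈ subspaces → B ∈ subspaces → sameᵇ (orth A) (orth B) ≡ sameᵇ B A
  sameᵇ-orth A B mA mB = cong₂ _∧_
    (T-ext (orth-⊆ᵇ-reflect A B (proj₁ (subspaces⁻ mA)) (proj₂ (subspaces⁻ mA))) (orth-⊆ᵇ-anti A B))
    (T-ext (orth-⊆ᵇ-reflect B A (proj₁ (subspaces⁻ mB)) (proj₂ (subspaces⁻ mB))) (orth-⊆ᵇ-anti B A))

  module SubspaceEq = DecEq (SubOnce._≟L_ (_≟V_ {n}))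

  𝟙-sameᵇ : ∀ {A B} → A ∈ sublists E → B ∈ sublists E → 𝟙 (sameᵇ A B) ≡ SubspaceEq.δ A B
  𝟙-sameᵇ {A} {B} mA mB = cong 𝟙 (T-ext
    (λ t → SubspaceEq.δ-T {x = A} {y = B} (SubDec.sublist-ext (_≟V_ {n}) E-unique mA mB (⊆-T {A} {B} (T-∧-l t)) (⊆-T {B} {A} (T-∧-r {A ⊆ᵇ B} t))))
    (λ t → subst (λ Z → T (sameᵇ Z B)) (sym (SubspaceEq.T-δ {x = A} {y = B} t)) (T-∧-intro {B ⊆ᵇ B} (⊆ᵇ-refl B) (⊆ᵇ-refl B))))

  ∑-sameᵇ-above : ∀ U {B} → B ∈ subspaces → T (U ⊆ᵇ B) → ∑ (filterᵇ (U ⊆ᵇ_) subspaces) (λ V → 𝟙 (sameᵇ V B)) ≡ 1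
  ∑-sameᵇ-above U {B} mB U⊆B = begin
    ∑ (filterᵇ (U ⊆ᵇ_) subspaces) (λ V → 𝟙 (sameᵇ V B))
      ≡⟨ ∑-cong (filterᵇ (U ⊆ᵇ_) subspaces) (λ V mV → 𝟙-sameᵇ (proj₁ (subspaces⁻ (proj₁ (filterᵇ-∈⁻ (U ⊆ᵇ_) {V} {subspaces} mV)))) B-sub) ⟩
    ∑ (filterᵇ (U ⊆ᵇ_) subspaces) (λ V → SubspaceEq.δ V B)
      ≡⟨ ∑-filter (U ⊆ᵇ_) subspaces _ ⟩
    ∑ subspaces (λ V → 𝟙 (U ⊆ᵇ V) *ℕ SubspaceEq.δ V B)
      ≡⟨ ∑-filter isSubspaceᵇ (sublists E) _ ⟩
    ∑ (sublists E) (λ V → 𝟙 (isSubspaceᵇ V) *ℕ (𝟙 (U ⊆ᵇ V) *ℕ SubspaceEq.δ V B))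
      ≡⟨ ∑-cong (sublists E) (λ V _ → rotate (𝟙 (isSubspaceᵇ V)) (𝟙 (U ⊆ᵇ V)) (SubspaceEq.δ V B)) ⟩
    ∑ (sublists E) (λ V → SubspaceEq.δ V B *ℕ (𝟙 (isSubspaceᵇ V) *ℕ 𝟙 (U ⊆ᵇ V)))
      ≡⟨ SubspaceEq.once-pick (sublists E) B _ (SubOnce.sublists-once (_≟V_ {n}) E-unique B-sub) ⟩
    𝟙 (isSubspaceᵇ B) *ℕ 𝟙 (U ⊆ᵇ B)
      ≡⟨ cong₂ _*ℕ_ (T⇒𝟙≡1 (proj₂ (filterᵇ-∈⁻ isSubspaceᵇ {B} {sublists E} mB))) (T⇒𝟙≡1 U⊆B) ⟩
    1 ∎
    where
    open ≡-Reasoning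
    B-sub = proj₁ (subspaces⁻ mB)
    rotate : ∀ a b c → a *ℕ (b *ℕ c) ≡ c *ℕ (a *ℕ b)
    rotate a b c = trans (sym (ℕP.*-assoc a b c)) (ℕP.*-comm (a *ℕ b) c)

module IntegerSums where

  open import Data.Bool using (Bool; true; false)
  open import Data.Nat using (ℕ; zero; suc) renaming (_+_ to _+ℕ_; _*_ to _*ℕ_)
  open import Data.Integer using (ℤ; +_; _+_; _*_)
  import Data.Integer as ℤ
  open import Data.Integer.Properties
  open import Algebra.Properties.CommutativeSemigroup +-commutativeSemigroup using (interchange)
  open import Data.List using (List; []; _∷_; map; filterᵇ; length)
  open import Data.List.Membership.Propositional using (_∈_)
  open import Data.List.Relation.Unary.Any using (here; there)
  open import Relation.Binary.PropositionalEquality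
  open import Defs using (sumℤ)
  open Counting using (∑; 𝟙; length-filter)

  ∑ℤ : {A : Set} → List A → (A → ℤ) → ℤ
  ∑ℤ xs f = sumℤ (map f xs)

  module _ {A : Set} where
    ∑ℤ-cong : ∀ (xs : List A) {f g : A → ℤ} → (∀ x → x ∈ xs → f x ≡ g x) → ∑ℤ xs f ≡ ∑ℤ xs g
    ∑ℤ-cong [] h = refl
    ∑ℤ-cong (x ∷ xs) h = cong₂ _+_ (h x (here refl)) (∑ℤ-cong xs (λ y m → h y (there m)))

    ∑ℤ-+ : ∀ (xs : List A) (f g : A → ℤ) → ∑ℤ xs (λ x → f x + g x) ≡ ∑ℤ xs f + ∑ℤ xs g
    ∑ℤ-+ [] f g = refl
    ∑ℤ-+ (x ∷ xs) f g rewrite ∑ℤ-+ xs f g = interchange (f x) (g x) (∑ℤ xs f) (∑ℤ xs g)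

    ∑ℤ-0 : ∀ (xs : List A) → ∑ℤ xs (λ _ → + 0) ≡ + 0
    ∑ℤ-0 [] = refl
    ∑ℤ-0 (x ∷ xs) = trans (+-identityˡ _) (∑ℤ-0 xs)

    ∑ℤ-*ˡ : ∀ (xs : List A) c (f : A → ℤ) → ∑ℤ xs (λ x → c * f x) ≡ c * ∑ℤ xs f
    ∑ℤ-*ˡ [] c f = sym (*-zeroʳ c)
    ∑ℤ-*ˡ (x ∷ xs) c f rewrite ∑ℤ-*ˡ xs c f = sym (*-distribˡ-+ c (f x) (∑ℤ xs f))

    ∑ℤ-pos : ∀ (xs : List A) (f : A → ℕ) → ∑ℤ xs (λ x → + f x) ≡ + ∑ xs f
    ∑ℤ-pos [] f = refl
    ∑ℤ-pos (x ∷ xs) f rewrite ∑ℤ-pos xs f = sym (pos-+ (f x) (∑ xs f))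

    ∑ℤ-filter : ∀ (p : A → Bool) (xs : List A) (f : A → ℤ) → ∑ℤ (filterᵇ p xs) f ≡ ∑ℤ xs (λ x → f x * + 𝟙 (p x))
    ∑ℤ-filter p [] f = refl
    ∑ℤ-filter p (x ∷ xs) f with p x
    ... | true = cong₂ _+_ (sym (*-identityʳ (f x))) (∑ℤ-filter p xs f)
    ... | false = trans (∑ℤ-filter p xs f) (sym (trans (cong (_+ ∑ℤ xs (λ y → f y * + 𝟙 (p y))) (*-zeroʳ (f x))) (+-identityˡ _)))

    ∑ℤ-𝟙 : ∀ (p : A → Bool) (xs : List A) → ∑ℤ xs (λ x → + 𝟙 (p x)) ≡ + length (filterᵇ p xs)
    ∑ℤ-𝟙 p xs = trans (∑ℤ-pos xs (λ x → 𝟙 (p x))) (cong +_ (sym (length-filter p xs)))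

  module _ {A B : Set} where
    ∑ℤ-swap : ∀ (xs : List A) (ys : List B) (f : A → B → ℤ) → ∑ℤ xs (λ x → ∑ℤ ys (f x)) ≡ ∑ℤ ys (λ y → ∑ℤ xs (λ x → f x y))
    ∑ℤ-swap [] ys f = sym (∑ℤ-0 ys)
    ∑ℤ-swap (x ∷ xs) ys f = trans (cong (λ z → ∑ℤ ys (f x) + z) (∑ℤ-swap xs ys f)) (sym (∑ℤ-+ ys (f x) (λ y → ∑ℤ xs (λ x' → f x' y))))

    ∑ℤ-*-pos-∑ : ∀ (xs : List A) (ys : List B) (c : A → ℤ) (f : A → B → ℕ) →
      ∑ℤ xs (λ a → c a * + ∑ ys (f a)) ≡ ∑ℤ ys (λ b → ∑ℤ xs (λ a → c a * + f a b))
    ∑ℤ-*-pos-∑ xs ys c f = trans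
      (∑ℤ-cong xs (λ a _ → trans (cong (c a *_) (sym (∑ℤ-pos ys (f a)))) (sym (∑ℤ-*ˡ ys (c a) (λ b → + f a b)))))
      (∑ℤ-swap xs ys (λ a b → c a * + f a b))

  pos-^ : ∀ a b → + (a Data.Nat.^ b) ≡ (+ a) ℤ.^ b
  pos-^ a zero = refl
  pos-^ a (suc b) = trans (pos-* a (a Data.Nat.^ b)) (cong (+ a *_) (pos-^ a b))

module Moebius (R : LatticeRank)
  (≤-refl : ∀ a → T (LatticeRank._≤ᵇ_ R a a))
  (≤-trans : ∀ a b c → T (LatticeRank._≤ᵇ_ R a b) → T (LatticeRank._≤ᵇ_ R b c) → T (LatticeRank._≤ᵇ_ R a c))
  (=-def : ∀ a b → LatticeRank._=ᵇ_ R a b ≡ (LatticeRank._≤ᵇ_ R a b ∧ LatticeRank._≤ᵇ_ R b a)) where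

  open import Data.Bool using (Bool; true; false; T; _∧_; not; if_then_else_)
  open import Relation.Binary.PropositionalEquality

  open import Data.Bool.Properties using (∧-assoc)
  open import Data.Nat using (ℕ; zero; suc; _≤_; _<_)
  open import Function using (_∘_)
  import Data.Nat
  open import Data.Sum using (inj₁; inj₂)
  import Data.Nat.Properties as ℕP
  open import Data.Integer using (ℤ; +_; _+_; _*_; -_)
  import Data.Integer.Properties as ℤP
  open import Data.List using (List; []; _∷_; map; filterᵇ; length)
  import Data.List.Properties as ListP
  open import Data.List.Membership.Propositional using (_∈_)
  open import Data.Product using (_×_; _,_; proj₁; proj₂; ∃)
  open import Data.Empty using (⊥; ⊥-elim)
  open import Data.Unit using (tt)
  open import Relation.Nullary using (¬_)
  open Counting
  open Enumeration using (filterᵇ-∈⁻; filter-cong; All-tab)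
  open import Data.List.Properties using (map-cong-local)
  open IntegerSums

  open LatticeRank R

  =-T : ∀ {x y} → T (x =ᵇ y) → T (x ≤ᵇ y) × T (y ≤ᵇ x)
  =-T {x} {y} t = let t' = subst T (=-def x y) t in T-∧-l t' , T-∧-r {x ≤ᵇ y} t'

  T-= : ∀ {x y} → T (x ≤ᵇ y) → T (y ≤ᵇ x) → T (x =ᵇ y)
  T-= {x} {y} p q = subst T (sym (=-def x y)) (T-∧-intro p q)

  T-not : ∀ {b} → ¬ T b → T (not b)
  T-not {true} h = h tt
  T-not {false} h = tt

  not-T : ∀ {b} → T (not b) → ¬ T b
  not-T {true} () _
  not-T {false} _ ()

  strictlyBetween : P → P → P → Bool
  strictlyBetween a b c = (a ≤ᵇ c) ∧ (c ≤ᵇ b) ∧ not (c =ᵇ b)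

  strictlyBelow : P → P → List P
  strictlyBelow a b = filterᵇ (strictlyBetween a b) elems

  #below : P → P → ℕ
  #below a b = length (strictlyBelow a b)

  strictlyBetween-T : ∀ {a b c} → T (strictlyBetween a b c) → T (a ≤ᵇ c) × T (c ≤ᵇ b) × ¬ T (c =ᵇ b)
  strictlyBetween-T {a} {b} {c} t = T-∧-l t , T-∧-l (T-∧-r {a ≤ᵇ c} t) , not-T (T-∧-r {c ≤ᵇ b} (T-∧-r {a ≤ᵇ c} t))

  T-strictlyBetween : ∀ {a b c} → T (a ≤ᵇ c) → T (c ≤ᵇ b) → ¬ T (c =ᵇ b) → T (strictlyBetween a b c)
  T-strictlyBetween p q r = T-∧-intro p (T-∧-intro q (T-not r))

  #strictlyBelow-< : ∀ a b c → c ∈ elems → T (strictlyBetween a b c) → #below a c < #below a b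
  #strictlyBelow-< a b c mc t = subst₂ _<_ (sym (length-filter (strictlyBetween a c) elems)) (sym (length-filter (strictlyBetween a b) elems))
    (count-strict elems (strictlyBetween a c) (strictlyBetween a b) below-c⇒below-b c mc t (λ t' → proj₂ (proj₂ (strictlyBetween-T t')) (T-= (≤-refl c) (≤-refl c))))
    where
    ac = proj₁ (strictlyBetween-T t)
    cb = proj₁ (proj₂ (strictlyBetween-T t))
    ncb = proj₂ (proj₂ (strictlyBetween-T t))
    below-c⇒below-b : ∀ x → x ∈ elems → T (strictlyBetween a c x) → T (strictlyBetween a b x)
    below-c⇒below-b x _ tx with strictlyBetween-T tx
    ... | ax , xc , _ = T-strictlyBetween ax (≤-trans x c b xc cb) (λ xb → ncb (T-= cb (≤-trans b x c (proj₂ (=-T xb)) xc)))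

  μStep : Bool → Bool → List ℤ → ℤ
  μStep x y l = if x then + 1 else (if y then - sumℤ l else + 0)

  μ'-suc : ∀ f a b → μ' (suc f) a b ≡ μStep (a =ᵇ b) (a ≤ᵇ b) (map (μ' f a) (strictlyBelow a b))
  μ'-suc f a b = refl

  μStep-[] : ∀ x y → μStep x y [] ≡ (if x then + 1 else + 0)
  μStep-[] true y = refl
  μStep-[] false true = refl
  μStep-[] false false = refl

  length≤0⇒[] : ∀ {A : Set} (xs : List A) → length xs ≤ 0 → xs ≡ []
  length≤0⇒[] [] _ = refl

  -- Fuel beyond the number of elements strictly below b is irrelevant; that number drops along the recursion.
  μ'-fuel : ∀ a f g b → #below a b ≤ f → #below a b ≤ g → μ' f a b ≡ μ' g a b
  μ'-fuel a zero zero b _ _ = refl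
  μ'-fuel a zero (suc g) b h1 _ = sym (trans (μ'-suc g a b) (trans (cong (λ l → μStep (a =ᵇ b) (a ≤ᵇ b) (map (μ' g a) l)) (length≤0⇒[] (strictlyBelow a b) h1)) (μStep-[] _ _)))
  μ'-fuel a (suc f) zero b _ h2 = trans (μ'-suc f a b) (trans (cong (λ l → μStep (a =ᵇ b) (a ≤ᵇ b) (map (μ' f a) l)) (length≤0⇒[] (strictlyBelow a b) h2)) (μStep-[] _ _))
  μ'-fuel a (suc f) (suc g) b h1 h2 = cong (μStep (a =ᵇ b) (a ≤ᵇ b)) (map-cong-local (All-tab (strictlyBelow a b) λ c mc →
    let (me , t) = filterᵇ-∈⁻ (strictlyBetween a b) {c} {elems} mc
        s = #strictlyBelow-< a b c me t
    in μ'-fuel a f g c (ℕP.≤-pred (ℕP.≤-trans s h1)) (ℕP.≤-pred (ℕP.≤-trans s h2))))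

  μ'-refl : ∀ f a b → T (a =ᵇ b) → μ' f a b ≡ + 1
  μ'-refl zero a b t with a =ᵇ b
  ... | true = refl
  μ'-refl (suc f) a b t with a =ᵇ b
  ... | true = refl

  μ-rec : ∀ a b → ¬ T (a =ᵇ b) → T (a ≤ᵇ b) → ∀ L' → length elems ≡ suc L' → μ a b ≡ - ∑ℤ (strictlyBelow a b) (μ a)
  μ-rec a b nab ab L' eL = trans (cong (λ z → μ' z a b) eL) (trans (μ'-suc L' a b) (trans (μStep-below (a =ᵇ b) (a ≤ᵇ b) nab ab {map (μ' L' a) (strictlyBelow a b)})
    (cong (λ l → - sumℤ l) (map-cong-local (All-tab (strictlyBelow a b) λ c mc →
      let (me , t) = filterᵇ-∈⁻ (strictlyBetween a b) {c} {elems} mc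
          s = #strictlyBelow-< a b c me t
          #below≤length : #below a b ≤ length elems
          #below≤length = ListP.length-filter _ elems
      in μ'-fuel a L' (length elems) c (ℕP.≤-pred (ℕP.≤-trans s (subst (#below a b ≤_) eL #below≤length))) (ℕP.<⇒≤ (ℕP.<-≤-trans s #below≤length)))))))
    where
    μStep-below : ∀ x y → ¬ T x → T y → ∀ {l} → μStep x y l ≡ - sumℤ l
    μStep-below false true _ _ = refl
    μStep-below true _ n _ = ⊥-elim (n tt)

  =ᵇ-respʳ : ∀ {a b c} → T (c =ᵇ b) → (a =ᵇ c) ≡ (a =ᵇ b)
  =ᵇ-respʳ {a} {b} {c} t = T-ext
    (λ ac → T-= (≤-trans a c b (proj₁ (=-T ac)) cb) (≤-trans b c a bc (proj₂ (=-T ac))))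
    (λ ab → T-= (≤-trans a b c (proj₁ (=-T ab)) bc) (≤-trans c b a cb (proj₂ (=-T ab))))
    where
    cb = proj₁ (=-T t)
    bc = proj₂ (=-T t)

  ≤ᵇ-respʳ : ∀ {a b c} → T (c =ᵇ b) → (a ≤ᵇ c) ≡ (a ≤ᵇ b)
  ≤ᵇ-respʳ {a} {b} {c} t = T-ext (λ ac → ≤-trans a c b ac (proj₁ (=-T t))) (λ ab → ≤-trans a b c ab (proj₂ (=-T t)))

  strictlyBelow-respʳ : ∀ {a b c} → T (c =ᵇ b) → strictlyBelow a c ≡ strictlyBelow a b
  strictlyBelow-respʳ {a} {b} {c} t = filter-cong elems _ _ (λ x _ → T-ext
    (λ tx → let (ax , xc , nxc) = strictlyBetween-T tx in T-strictlyBetween ax (≤-trans x c b xc cb) (λ xb → nxc (T-= xc (≤-trans c b x cb (proj₂ (=-T xb))))))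
    (λ tx → let (ax , xb , nxb) = strictlyBetween-T tx in T-strictlyBetween ax (≤-trans x b c xb bc) (λ xc → nxb (T-= xb (≤-trans b c x bc (proj₂ (=-T xc)))))))
    where
    cb = proj₁ (=-T t)
    bc = proj₂ (=-T t)

  μ'-resp-=ᵇ : ∀ f a b c → T (c =ᵇ b) → μ' f a c ≡ μ' f a b
  μ'-resp-=ᵇ zero a b c t = cong (λ x → if x then + 1 else + 0) (=ᵇ-respʳ t)
  μ'-resp-=ᵇ (suc f) a b c t = cong₃ μStep (=ᵇ-respʳ t) (≤ᵇ-respʳ t) (cong (map (μ' f a)) (strictlyBelow-respʳ t))
    where
    cong₃ : ∀ {A B C D : Set} (h : A → B → C → D) {x x' y y' z z'} → x ≡ x' → y ≡ y' → z ≡ z' → h x y z ≡ h x' y' z'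
    cong₃ h refl refl refl = refl

  𝟙-split : ∀ x y → 𝟙 x ≡ 𝟙 (x ∧ y) Data.Nat.+ 𝟙 (x ∧ not y)
  𝟙-split true true = refl
  𝟙-split true false = refl
  𝟙-split false y = refl

  ∑-μ-split : ∀ a b → T (a ≤ᵇ b) →
    ∑ℤ elems (λ c → μ a c * + 𝟙 ((a ≤ᵇ c) ∧ (c ≤ᵇ b)))
      ≡ ∑ℤ elems (λ c → μ a c * + 𝟙 (c =ᵇ b)) + ∑ℤ (strictlyBelow a b) (μ a)
  ∑-μ-split a b ab = begin
    ∑ℤ elems (λ c → μ a c * + 𝟙 (between c))
      ≡⟨ ∑ℤ-cong elems (λ c _ → split c) ⟩
    ∑ℤ elems (λ c → μ a c * + 𝟙 (c =ᵇ b) + μ a c * + 𝟙 (strictlyBetween a b c))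
      ≡⟨ ∑ℤ-+ elems _ _ ⟩
    ∑ℤ elems (λ c → μ a c * + 𝟙 (c =ᵇ b)) + ∑ℤ elems (λ c → μ a c * + 𝟙 (strictlyBetween a b c))
      ≡⟨ cong (λ z → ∑ℤ elems (λ c → μ a c * + 𝟙 (c =ᵇ b)) + z) (sym (∑ℤ-filter (strictlyBetween a b) elems (μ a))) ⟩
    ∑ℤ elems (λ c → μ a c * + 𝟙 (c =ᵇ b)) + ∑ℤ (strictlyBelow a b) (μ a) ∎
    where
    open ≡-Reasoning
    between : P → Bool
    between c = (a ≤ᵇ c) ∧ (c ≤ᵇ b)
    at-top : ∀ c → (between c ∧ (c =ᵇ b)) ≡ (c =ᵇ b)
    at-top c = T-ext (T-∧-r {between c}) (λ t → T-∧-intro (T-∧-intro (≤-trans a b c ab (proj₂ (=-T t))) (proj₁ (=-T t))) t)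
    split : ∀ c → μ a c * + 𝟙 (between c) ≡ μ a c * + 𝟙 (c =ᵇ b) + μ a c * + 𝟙 (strictlyBetween a b c)
    split c = begin
      μ a c * + 𝟙 (between c)
        ≡⟨ cong (λ z → μ a c * + z) (𝟙-split (between c) (c =ᵇ b)) ⟩
      μ a c * + (𝟙 (between c ∧ (c =ᵇ b)) Data.Nat.+ 𝟙 (between c ∧ not (c =ᵇ b)))
        ≡⟨ cong₂ (λ u v → μ a c * + (𝟙 u Data.Nat.+ 𝟙 v)) (at-top c) (∧-assoc (a ≤ᵇ c) (c ≤ᵇ b) (not (c =ᵇ b))) ⟩
      μ a c * (+ 𝟙 (c =ᵇ b) + + 𝟙 (strictlyBetween a b c))
        ≡⟨ ℤP.*-distribˡ-+ (μ a c) _ _ ⟩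
      μ a c * + 𝟙 (c =ᵇ b) + μ a c * + 𝟙 (strictlyBetween a b c) ∎

  ∑-μ-top : ∀ a b → ∑ elems (λ c → 𝟙 (c =ᵇ b)) ≡ 1 → ∑ℤ elems (λ c → μ a c * + 𝟙 (c =ᵇ b)) ≡ μ a b
  ∑-μ-top a b once = begin
    ∑ℤ elems (λ c → μ a c * + 𝟙 (c =ᵇ b)) ≡⟨ ∑ℤ-cong elems (λ c _ → μ-at-top c) ⟩
    ∑ℤ elems (λ c → μ a b * + 𝟙 (c =ᵇ b)) ≡⟨ ∑ℤ-*ˡ elems (μ a b) _ ⟩
    μ a b * ∑ℤ elems (λ c → + 𝟙 (c =ᵇ b)) ≡⟨ cong (μ a b *_) (trans (∑ℤ-pos elems _) (cong +_ once)) ⟩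
    μ a b * + 1 ≡⟨ ℤP.*-identityʳ (μ a b) ⟩
    μ a b ∎
    where
    open ≡-Reasoning
    μ-at-top : ∀ c → μ a c * + 𝟙 (c =ᵇ b) ≡ μ a b * + 𝟙 (c =ᵇ b)
    μ-at-top c with T-dec (c =ᵇ b)
    ... | inj₁ t = cong (_* + 𝟙 (c =ᵇ b)) (μ'-resp-=ᵇ (length elems) a b c t)
    ... | inj₂ nt rewrite ¬T⇒𝟙≡0 nt = trans (ℤP.*-zeroʳ (μ a c)) (sym (ℤP.*-zeroʳ (μ a b)))

  μ-recurrence : ∀ a b → T (a ≤ᵇ b) → ∑ elems (λ c → 𝟙 (c =ᵇ b)) ≡ 1 →
    μ a b + ∑ℤ (strictlyBelow a b) (μ a) ≡ + 𝟙 (a =ᵇ b)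
  μ-recurrence a b ab once with T-dec (a =ᵇ b)
  ... | inj₁ t = begin
    μ a b + ∑ℤ (strictlyBelow a b) (μ a) ≡⟨ cong₂ _+_ (μ'-refl (length elems) a b t) (∑ℤ-cong (strictlyBelow a b) (λ c mc → ⊥-elim (no-c c mc))) ⟩
    + 1 + ∑ℤ (strictlyBelow a b) (λ _ → + 0) ≡⟨ cong (λ z → + 1 + z) (∑ℤ-0 (strictlyBelow a b)) ⟩
    + 1 ≡⟨ cong +_ (sym (T⇒𝟙≡1 t)) ⟩
    + 𝟙 (a =ᵇ b) ∎
    where
    open ≡-Reasoning
    no-c : ∀ c → c ∈ strictlyBelow a b → ⊥
    no-c c mc with strictlyBetween-T (proj₂ (filterᵇ-∈⁻ (strictlyBetween a b) {c} {elems} mc))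
    ... | ac , cb , ncb = ncb (T-= cb (≤-trans b a c (proj₂ (=-T t)) ac))
  ... | inj₂ nt = let (L' , eL) = nonempty elems once in begin
    μ a b + ∑ℤ (strictlyBelow a b) (μ a) ≡⟨ cong (_+ ∑ℤ (strictlyBelow a b) (μ a)) (μ-rec a b nt ab L' eL) ⟩
    - ∑ℤ (strictlyBelow a b) (μ a) + ∑ℤ (strictlyBelow a b) (μ a) ≡⟨ ℤP.+-inverseˡ (∑ℤ (strictlyBelow a b) (μ a)) ⟩
    + 0 ≡⟨ cong +_ (sym (¬T⇒𝟙≡0 nt)) ⟩
    + 𝟙 (a =ᵇ b) ∎
    where
    open ≡-Reasoning
    nonempty : ∀ (xs : List P) → ∑ xs (λ c → 𝟙 (c =ᵇ b)) ≡ 1 → ∃ λ L' → length xs ≡ suc L'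
    nonempty (_ ∷ xs) _ = length xs , refl

  ∑-μ-interval : ∀ a b → (T (a ≤ᵇ b) → ∑ elems (λ c → 𝟙 (c =ᵇ b)) ≡ 1) →
    ∑ℤ elems (λ c → μ a c * + 𝟙 ((a ≤ᵇ c) ∧ (c ≤ᵇ b))) ≡ + 𝟙 (a =ᵇ b)
  ∑-μ-interval a b once with T-dec (a ≤ᵇ b)
  ... | inj₁ ab = begin
    ∑ℤ elems (λ c → μ a c * + 𝟙 ((a ≤ᵇ c) ∧ (c ≤ᵇ b))) ≡⟨ ∑-μ-split a b ab ⟩
    ∑ℤ elems (λ c → μ a c * + 𝟙 (c =ᵇ b)) + ∑ℤ (strictlyBelow a b) (μ a) ≡⟨ cong (_+ ∑ℤ (strictlyBelow a b) (μ a)) (∑-μ-top a b (once ab)) ⟩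
    μ a b + ∑ℤ (strictlyBelow a b) (μ a) ≡⟨ μ-recurrence a b ab (once ab) ⟩
    + 𝟙 (a =ᵇ b) ∎
    where open ≡-Reasoning
  ... | inj₂ nab = begin
    ∑ℤ elems (λ c → μ a c * + 𝟙 ((a ≤ᵇ c) ∧ (c ≤ᵇ b))) ≡⟨ ∑ℤ-cong elems (λ c _ → cong (λ z → μ a c * + z) (¬T⇒𝟙≡0 (outside c))) ⟩
    ∑ℤ elems (λ c → μ a c * + 0) ≡⟨ ∑ℤ-cong elems (λ c _ → ℤP.*-zeroʳ (μ a c)) ⟩
    ∑ℤ elems (λ _ → + 0) ≡⟨ ∑ℤ-0 elems ⟩
    + 0 ≡⟨ cong +_ (sym (¬T⇒𝟙≡0 (nab ∘ proj₁ ∘ =-T))) ⟩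
    + 𝟙 (a =ᵇ b) ∎
    where
    open ≡-Reasoning
    outside : ∀ c → ¬ T ((a ≤ᵇ c) ∧ (c ≤ᵇ b))
    outside c t = nab (≤-trans a c b (T-∧-l t) (T-∧-r {a ≤ᵇ c} t))

module ExtensionField (K : FiniteField) (m : ℕ) (X : Extension K m) where

  open import Data.Nat using (ℕ)

  open import Data.Nat using (_≤_; z≤n; s≤s; _^_) renaming (_+_ to _+ℕ_; _*_ to _*ℕ_)
  import Data.Nat.Properties as ℕP
  import Data.List.Properties as ListP
  open import Data.List using (List; []; _∷_; length)
  open import Data.Vec using (Vec; []; _∷_; zipWith)
  import Data.Vec as Vec
  import Data.Vec.Properties as VecP
  open import Data.Empty using (⊥-elim)
  open import Relation.Binary.PropositionalEquality
  open import Relation.Nullary using (yes; no)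
  open Counting
  open Enumeration

  open Extension X
  module KK = FiniteField K
  module KF = FieldVectors KK.field'
  module LF = FieldVectors L
  module VK = VecOps KK.field'
  module VL = VecOps L

  ι-0 : ι KK.0# ≡ L.0#
  ι-0 = LF.x+x≡x⇒x≡0 (trans (sym (ι-+ KK.0# KK.0#)) (cong ι (KF.+-identityˡ KK.0#)))

  combG : ∀ {m'} → Vec L.Carrier m' → Vec KK.Carrier m' → L.Carrier
  combG g a = Vec.foldr _ L._+_ L.0# (zipWith (λ ai γ → ι ai L.* γ) a g)

  combG-+ : ∀ {m'} (g : Vec L.Carrier m') a b → combG g (a VK.+V b) ≡ (combG g a L.+ combG g b)
  combG-+ [] [] [] = sym (LF.+-identityˡ L.0#)
  combG-+ (γ ∷ g) (x ∷ a) (y ∷ b) rewrite combG-+ g a b | ι-+ x y =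
    trans (cong (L._+ (combG g a L.+ combG g b)) (LF.distribʳ γ (ι x) (ι y))) (LF.interchange (ι x L.* γ) (ι y L.* γ) (combG g a) (combG g b))

  combG-· : ∀ {m'} (g : Vec L.Carrier m') c a → combG g (c VK.·V a) ≡ (ι c L.* combG g a)
  combG-· [] c [] = sym (LF.zeroʳ (ι c))
  combG-· (γ ∷ g) c (x ∷ a) rewrite combG-· g c a | ι-* c x =
    trans (cong (L._+ (ι c L.* combG g a)) (LF.*-assoc (ι c) (ι x) γ)) (sym (LF.distribˡ (ι c) _ _))

  combG-0 : ∀ {m'} (g : Vec L.Carrier m') → combG g VK.zeroV ≡ L.0#
  combG-0 [] = refl
  combG-0 (γ ∷ g) rewrite combG-0 g | ι-0 = trans (LF.+-identityʳ _) (LF.zeroˡ γ)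

  coord-+ : ∀ x y → coord (x L.+ y) ≡ (coord x VK.+V coord y)
  coord-+ x y = trans (cong coord (sym (trans (combG-+ Γ (coord x) (coord y)) (cong₂ L._+_ (comb-coord x) (comb-coord y))))) (coord-comb _)

  coord-· : ∀ c x → coord (ι c L.* x) ≡ (c VK.·V coord x)
  coord-· c x = trans (cong coord (sym (trans (combG-· Γ c (coord x)) (cong (ι c L.*_) (comb-coord x))))) (coord-comb _)

  coord-0 : coord L.0# ≡ VK.zeroV
  coord-0 = trans (cong coord (sym (combG-0 Γ))) (coord-comb _)

  coord-inj : ∀ {x y} → coord x ≡ coord y → x ≡ y
  coord-inj {x} {y} e = trans (sym (comb-coord x)) (trans (cong comb e) (comb-coord y))

  elems-once : ∀ a → DecEq.Once KK._≟_ KK.elems a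
  elems-once a = SubDec.unique-once KK._≟_ KK.elems-unique (KK.elems-complete a)

  elemsL-once : ∀ a → DecEq.Once L._≟_ elemsL a
  elemsL-once a = trans (∑-map comb (allVecs KK.elems m) (λ x → DecEq.δ L._≟_ x a))
    (trans (∑-cong (allVecs KK.elems m) (λ v _ → δ-comb v))
           (VecDec.allVecs-once KK._≟_ KK.elems elems-once m (coord a)))
    where
    δ-comb : ∀ v → DecEq.δ L._≟_ (comb v) a ≡ DecEq.δ (VecP.≡-dec KK._≟_) v (coord a)
    δ-comb v with comb v L.≟ a | VecP.≡-dec KK._≟_ v (coord a)
    ... | yes _ | yes _ = refl
    ... | yes e | no ne = ⊥-elim (ne (trans (sym (coord-comb v)) (cong coord e)))
    ... | no ne | yes e = ⊥-elim (ne (trans (cong comb e) (comb-coord a)))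
    ... | no _ | no _ = refl

  Q : ℕ
  Q = length elemsL

  Q≡q^m : Q ≡ KK.q ^ m
  Q≡q^m = trans (ListP.length-map comb (allVecs KK.elems m)) (length-allVecs KK.elems m)

  Q≥2 : 2 ≤ Q
  Q≥2 = ℕP.≤-trans (ℕP.≤-reflexive (cong₂ _+ℕ_ (sym (elemsL-once L.0#)) (sym (elemsL-once L.1#))))
          (ℕP.≤-trans (ℕP.≤-reflexive (sym (∑-+ elemsL (λ x → δ x L.0#) (λ x → δ x L.1#))))
          (ℕP.≤-trans (∑-mono elemsL (λ x _ → δ0+δ1≤1 x)) (ℕP.≤-reflexive (∑-1≡length elemsL))))
    where
    open DecEq L._≟_
    δ0+δ1≤1 : ∀ x → (δ x L.0# +ℕ δ x L.1#) ≤ 1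
    δ0+δ1≤1 x with x L.≟ L.0# | x L.≟ L.1#
    ... | yes refl | yes e = ⊥-elim (L.0≢1 e)
    ... | yes _ | no _ = s≤s z≤n
    ... | no _ | yes _ = s≤s z≤n
    ... | no _ | no _ = z≤n

module PowerArithmetic where

  open import Data.Nat
  open import Data.Nat.Properties
  open import Data.Product using (_×_; _,_)
  open import Relation.Binary.PropositionalEquality
  open import Relation.Nullary using (yes; no; contradiction)

  ^-cancelʳ-≤ : ∀ Q → 2 ≤ Q → ∀ a b → Q ^ a ≤ Q ^ b → a ≤ b
  ^-cancelʳ-≤ Q 1<Q a b h with a ≤? b
  ... | yes a≤b = a≤b
  ... | no a≰b = contradiction h (<⇒≱ (^-monoʳ-< Q 1<Q (≰⇒> a≰b)))

  c*Q^a≡Q^b⇒ : ∀ Q → 2 ≤ Q → ∀ c a b → 1 ≤ c → c * Q ^ a ≡ Q ^ b → a ≤ b × c ≡ Q ^ (b ∸ a)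
  c*Q^a≡Q^b⇒ Q q2 c a b c1 e = a≤b , ceq
    where
    a≤b : a ≤ b
    a≤b = ^-cancelʳ-≤ Q q2 a b (≤-trans (m≤n*m (Q ^ a) c {{>-nonZero c1}}) (≤-reflexive e))
    ceq : c ≡ Q ^ (b ∸ a)
    ceq = *-cancelʳ-≡ c (Q ^ (b ∸ a)) (Q ^ a) {{m^n≢0 Q a {{>-nonZero (≤-trans (s≤s z≤n) q2)}}}}
            (trans e (trans (cong (Q ^_) (sym (m∸n+n≡m a≤b))) (trans (^-distribˡ-+-* Q (b ∸ a) a) refl)))

  ∸-∸-cancel : ∀ a b c → c ≤ b → b ≤ a → (a ∸ c) ∸ (b ∸ c) ≡ a ∸ b
  ∸-∸-cancel a b c cb ba = begin-equality
    (a ∸ c) ∸ (b ∸ c) ≡⟨ cong (λ z → z ∸ (b ∸ c)) e ⟩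
    ((a ∸ b) + (b ∸ c)) ∸ (b ∸ c) ≡⟨ m+n∸n≡m (a ∸ b) (b ∸ c) ⟩
    a ∸ b ∎
    where
    open ≤-Reasoning
    e : a ∸ c ≡ (a ∸ b) + (b ∸ c)
    e = sym (trans (sym (+-∸-assoc (a ∸ b) cb)) (cong (_∸ c) (m∸n+n≡m ba)))

  ^-*-swap : ∀ q m t e → (q ^ (m * t)) ^ e ≡ ((q ^ m) ^ e) ^ t
  ^-*-swap q m t e = trans (^-*-assoc q (m * t) e) (trans (cong (q ^_) (trans (*-assoc m t e) (cong (m *_) (*-comm t e))))
    (sym (trans (^-*-assoc (q ^ m) e t) (^-*-assoc q m (e * t)))))

module CodeCounting (K : FiniteField) (m : ℕ) (X : Extension K m) (k n : ℕ)
             (G : Vec (Vec (Field.Carrier (Extension.L X)) n) k) where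

  open import Data.Bool using (Bool; true; T; _∧_)
  open import Data.Nat using (ℕ; zero; suc; _≤_; _^_; _∸_) renaming (_+_ to _+ℕ_; _*_ to _*ℕ_)
  import Data.Nat.Properties as ℕP
  open import Data.List using (List; []; _∷_; map; concat)
  import Data.List.Properties as ListP
  open import Data.Bool.ListAction using (all)
  open import Data.List.Membership.Propositional using (_∈_)
  open import Data.List.Relation.Unary.All using ([]; _∷_)
  open import Data.Vec using (Vec; []; _∷_; lookup; toList)
  import Data.Vec as Vec
  import Data.Vec.Properties as VecP
  import Data.Vec.Membership.Propositional.Properties as VecM
  open import Data.List.Membership.Propositional.Properties using (∈-map⁻; ∈-concat⁺′; ∈-concat⁻′)
  open import Data.Fin using (Fin)
  open import Data.Product using (_×_; _,_; proj₁; proj₂; ∃)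
  open import Data.Sum using (inj₁; inj₂)
  open import Relation.Binary.PropositionalEquality
  open import Relation.Nullary using (does)
  open import Function using (_∘_)
  open Counting
  open Enumeration
  open PowerArithmetic

  open Extension X
  open ExtensionField K m X
  open Code X G using (Gy; ρ; inCᵇ; codewords; columnsΓ; SR)
  open Subspaces K n
  module LAL = FiniteLinearAlgebra L elemsL elemsL-once
  open VecDec L._≟_ using (_≟V_; module DV)
  module SK = SubspaceFacts K n
  open ≡-Reasoning

  codeword : Vec L.Carrier k → Vec L.Carrier n
  codeword c = VL.lincomb (toList c) (toList G)

  annihilatesᵇ : List Vn → Vec L.Carrier n → Bool
  annihilatesᵇ V v = all (λ u → VL.isZeroᵇ (VL.dot v (Vec.map ι u))) V

  dot-Gy-gen : ∀ {k'} (G' : Vec (Vec L.Carrier n) k') (c : Vec L.Carrier k') y →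
    VL.dot c (Vec.map (λ row → VL.dot row y) G') ≡ VL.dot (VL.lincomb (toList c) (toList G')) y
  dot-Gy-gen [] [] y = sym (LF.dot-0ˡ y)
  dot-Gy-gen (g ∷ G') (c ∷ cs) y = sym (trans (LF.dot-+ˡ (c VL.·V g) _ y) (cong₂ L._+_ (LF.dot-·ˡ c g y) (sym (dot-Gy-gen G' cs y))))

  dot-Gy : ∀ c u → VL.dot c (Gy u) ≡ VL.dot (codeword c) (Vec.map ι u)
  dot-Gy c u = dot-Gy-gen G c (Vec.map ι u)

  solᵇ-Gy≡annihilatesᵇ : ∀ V c → LAL.solᵇ (map Gy V) c ≡ annihilatesᵇ V (codeword c)
  solᵇ-Gy≡annihilatesᵇ V c = cong (Data.List.foldr _∧_ true) (trans (sym (ListP.map-∘ V)) (ListP.map-cong (λ u → cong VL.isZeroᵇ (dot-Gy c u)) V))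

  ιzeroV : ∀ {n'} → Vec.map ι (VK.zeroV {n'}) ≡ VL.zeroV
  ιzeroV {zero} = refl
  ιzeroV {suc n'} = cong₂ _∷_ ι-0 ιzeroV

  ⊥ι⇒≡zeroV : ∀ {n'} (w : Vec L.Carrier n') → (∀ u → VL.dot w (Vec.map ι u) ≡ L.0#) → w ≡ VL.zeroV
  ⊥ι⇒≡zeroV [] h = refl
  ⊥ι⇒≡zeroV (w0 ∷ w) h = cong₂ _∷_ w0≡0 (⊥ι⇒≡zeroV w (λ u → trans (sym (lem2 u)) (h (KK.0# ∷ u))))
    where
    w0≡0 : w0 ≡ L.0#
    w0≡0 = trans (sym (trans (cong₂ L._+_ (trans (cong (w0 L.*_) ι-1) (LF.*-identityʳ w0)) (trans (cong (VL.dot w) ιzeroV) (LF.dot-0ʳ w))) (LF.+-identityʳ w0))) (h (KK.1# ∷ VK.zeroV))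
    lem2 : ∀ u → VL.dot (w0 ∷ w) (Vec.map ι (KK.0# ∷ u)) ≡ VL.dot w (Vec.map ι u)
    lem2 u = trans (cong (L._+ VL.dot w (Vec.map ι u)) (trans (cong (w0 L.*_) ι-0) (LF.zeroʳ w0))) (LF.+-identityˡ _)

  codeword-+ : ∀ c d → codeword (c VL.+V d) ≡ (codeword c VL.+V codeword d)
  codeword-+ c d = LF.lincomb-+ c d (toList G)

  codeword-0 : codeword VL.zeroV ≡ VL.zeroV
  codeword-0 = LF.lincomb-zero _ (toList G) (LF.zeroV-entries k)

  kernelSize : ℕ
  kernelSize = ∑ (allVecs elemsL k) (λ c → DV.δ (codeword c) VL.zeroV)

  -- Translating messages by a preimage cv of v maps the kernel onto the fibre over v.
  codeword-fibre : ∀ v → T (inCᵇ v) → ∑ (allVecs elemsL k) (λ c → DV.δ v (codeword c)) ≡ kernelSize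
  codeword-fibre v t with any-T _ (allVecs elemsL k) t
  ... | cv , _ , cv↦ᵇv = trans (sym (DV.∑-reindex (allVecs elemsL k) (LAL.allVecs-once' k) shift unshift unshift∘shift shift∘unshift (λ c → DV.δ v (codeword c))))
                             (∑-cong (allVecs elemsL k) (λ c _ → δ-shift c))
    where
    cv↦v : codeword cv ≡ v
    cv↦v = LAL.eqᵇ⇒≡ cv↦ᵇv
    shift unshift : Vec L.Carrier k → Vec L.Carrier k
    shift c = c VL.+V cv
    unshift c = c VL.+V ((L.- L.1#) VL.·V cv)
    unshift∘shift : ∀ c → unshift (shift c) ≡ c
    unshift∘shift c = trans (LF.+V-assoc c cv _) (trans (cong (c VL.+V_) (LF.+V-neg cv)) (LF.+V-idʳ c))
    shift∘unshift : ∀ c → shift (unshift c) ≡ c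
    shift∘unshift c = trans (LF.+V-assoc c _ cv) (trans (cong (c VL.+V_) (trans (LF.+V-comm _ cv) (LF.+V-neg cv))) (LF.+V-idʳ c))
    δ-shift : ∀ c → DV.δ v (codeword (shift c)) ≡ DV.δ (codeword c) VL.zeroV
    δ-shift c = DV.δ-ext {x = v} {y = codeword (shift c)} {u = codeword c} {v = VL.zeroV}
      (λ e → LF.+V-cancel-zeroV (codeword c) v (sym (trans e (trans (codeword-+ c cv) (cong (codeword c VL.+V_) cv↦v)))))
      (λ e → sym (trans (codeword-+ c cv) (trans (cong₂ VL._+V_ e cv↦v) (LF.+V-idˡ v))))

  codeword-inC : ∀ c → T (inCᵇ (codeword c))
  codeword-inC c = T-any _ (allVecs elemsL k) c (LAL.allVecs-∈ k c) (LAL.≡⇒eqᵇ {u = codeword c} {v = codeword c} refl)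

  subcodeSize : List Vn → ℕ
  subcodeSize V = ∑ codewords (λ v → 𝟙 (annihilatesᵇ V v))

  count-messages : ∀ V → LAL.count k (λ c → annihilatesᵇ V (codeword c)) ≡ subcodeSize V *ℕ kernelSize
  count-messages V = begin
    ∑ Lk (λ c → 𝟙 (annihilatesᵇ V (codeword c)))
      ≡⟨ ∑-cong Lk (λ c _ → sym (pick-codeword c)) ⟩
    ∑ Lk (λ c → ∑ Ln (λ v → DV.δ v (codeword c) *ℕ weight v))
      ≡⟨ ∑-swap Lk Ln _ ⟩
    ∑ Ln (λ v → ∑ Lk (λ c → DV.δ v (codeword c) *ℕ weight v))
      ≡⟨ ∑-cong Ln (λ v _ → ∑-*ʳ Lk (weight v) (λ c → DV.δ v (codeword c))) ⟩
    ∑ Ln (λ v → ∑ Lk (λ c → DV.δ v (codeword c)) *ℕ weight v)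
      ≡⟨ ∑-cong Ln (λ v _ → fibre-weight v) ⟩
    ∑ Ln (λ v → 𝟙 (inCᵇ v) *ℕ 𝟙 (annihilatesᵇ V v) *ℕ kernelSize)
      ≡⟨ ∑-*ʳ Ln kernelSize _ ⟩
    ∑ Ln (λ v → 𝟙 (inCᵇ v) *ℕ 𝟙 (annihilatesᵇ V v)) *ℕ kernelSize
      ≡⟨ cong (_*ℕ kernelSize) (sym (∑-filter inCᵇ Ln (λ v → 𝟙 (annihilatesᵇ V v)))) ⟩
    subcodeSize V *ℕ kernelSize ∎
    where
    Lk = allVecs elemsL k
    Ln = allVecs elemsL n
    weight : Vec L.Carrier n → ℕ
    weight v = 𝟙 (inCᵇ v) *ℕ 𝟙 (annihilatesᵇ V v)
    pick-codeword : ∀ c → ∑ Ln (λ v → DV.δ v (codeword c) *ℕ weight v) ≡ 𝟙 (annihilatesᵇ V (codeword c))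
    pick-codeword c = trans (DV.once-pick Ln (codeword c) weight (LAL.allVecs-once' n (codeword c)))
      (trans (cong (_*ℕ 𝟙 (annihilatesᵇ V (codeword c))) (T⇒𝟙≡1 (codeword-inC c))) (ℕP.+-identityʳ _))
    fibre-weight : ∀ v → ∑ Lk (λ c → DV.δ v (codeword c)) *ℕ weight v ≡ 𝟙 (inCᵇ v) *ℕ 𝟙 (annihilatesᵇ V v) *ℕ kernelSize
    fibre-weight v with T-dec (inCᵇ v)
    ... | inj₁ t rewrite codeword-fibre v t = ℕP.*-comm kernelSize (weight v)
    ... | inj₂ nt rewrite ¬T⇒𝟙≡0 nt = ℕP.*-zeroʳ (∑ Lk (λ c → DV.δ v (codeword c)))

  kernelSize≡solutions : kernelSize ≡ LAL.count k (LAL.solᵇ (map Gy E))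
  kernelSize≡solutions = ∑-cong (allVecs elemsL k) (λ c _ → trans (cong 𝟙 (T-ext (to {c}) (from {c}))) (cong 𝟙 (sym (solᵇ-Gy≡annihilatesᵇ E c))))
    where
    to : ∀ {c} → T (does (codeword c ≟V VL.zeroV)) → T (annihilatesᵇ E (codeword c))
    to {c} t = T-all _ E (λ u _ → LAL.≡0⇒isZeroᵇ (trans (cong (λ z → VL.dot z (Vec.map ι u)) (DV.T-δ {x = codeword c} {y = VL.zeroV} t)) (LF.dot-0ˡ (Vec.map ι u))))
    from : ∀ {c} → T (annihilatesᵇ E (codeword c)) → T (does (codeword c ≟V VL.zeroV))
    from {c} t = DV.δ-T {x = codeword c} {y = VL.zeroV} (⊥ι⇒≡zeroV (codeword c) (λ u → LAL.isZeroᵇ⇒≡0 (all-T _ E t u (SK.E-∈ u))))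

  kernelSize≥1 : 1 ≤ kernelSize
  kernelSize≥1 = ℕP.≤-trans (ℕP.≤-reflexive (sym zero∈kernel)) (∑-term (allVecs elemsL k) (λ c → DV.δ (codeword c) VL.zeroV) VL.zeroV (LAL.allVecs-∈ k VL.zeroV))
    where
    zero∈kernel : DV.δ (codeword VL.zeroV) VL.zeroV ≡ 1
    zero∈kernel = T⇒𝟙≡1 (DV.δ-T {x = codeword VL.zeroV} {y = VL.zeroV} codeword-0)

  -- Multiplied by kernelSize both sides equal Q^k, by count-solutions for the systems G·Y_V and G·Y_E.
  subcodeSize*Q^ρ≡Q^ρE : ∀ V → subcodeSize V *ℕ Q ^ ρ V ≡ Q ^ ρ E
  subcodeSize*Q^ρ≡Q^ρE V = ℕP.*-cancelˡ-≡ (subcodeSize V *ℕ Q ^ ρ V) (Q ^ ρ E) kernelSize {{Data.Nat.>-nonZero kernelSize≥1}} (begin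
    kernelSize *ℕ (subcodeSize V *ℕ Q ^ ρ V)
      ≡⟨ sym (ℕP.*-assoc kernelSize (subcodeSize V) _) ⟩
    (kernelSize *ℕ subcodeSize V) *ℕ Q ^ ρ V
      ≡⟨ cong (_*ℕ Q ^ ρ V) (trans (ℕP.*-comm kernelSize (subcodeSize V)) (sym (trans (∑-cong (allVecs elemsL k) (λ c _ → cong 𝟙 (solᵇ-Gy≡annihilatesᵇ V c))) (count-messages V)))) ⟩
    LAL.count k (LAL.solᵇ (map Gy V)) *ℕ Q ^ ρ V
      ≡⟨ LAL.count-solutions k (map Gy V) ⟩
    Q ^ k
      ≡⟨ sym (LAL.count-solutions k (map Gy E)) ⟩
    LAL.count k (LAL.solᵇ (map Gy E)) *ℕ Q ^ ρ E
      ≡⟨ cong (_*ℕ Q ^ ρ E) (sym kernelSize≡solutions) ⟩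
    kernelSize *ℕ Q ^ ρ E ∎)
    where import Data.Nat

  column : ∀ {n'} → Vec L.Carrier n' → Fin m → Vec KK.Carrier n'
  column v j = Vec.map (λ vi → lookup (coord vi) j) v

  column-dot : ∀ {n'} (v : Vec L.Carrier n') (u : Vec KK.Carrier n') j → VK.dot (column v j) u ≡ lookup (coord (VL.dot v (Vec.map ι u))) j
  column-dot [] [] j = sym (trans (cong (λ z → lookup z j) coord-0) (VecP.lookup-replicate j KK.0#))
  column-dot (v0 ∷ v) (u0 ∷ u) j = sym (begin
    lookup (coord ((v0 L.* ι u0) L.+ R)) j
      ≡⟨ cong (λ z → lookup z j) (coord-+ (v0 L.* ι u0) R) ⟩
    lookup (coord (v0 L.* ι u0) VK.+V coord R) j
      ≡⟨ VecP.lookup-zipWith KK._+_ j (coord (v0 L.* ι u0)) (coord R) ⟩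
    lookup (coord (v0 L.* ι u0)) j KK.+ lookup (coord R) j
      ≡⟨ cong₂ KK._+_ (trans (cong (λ z → lookup (coord z) j) (LF.*-comm v0 (ι u0))) (trans (cong (λ z → lookup z j) (coord-· u0 v0)) (trans (VecP.lookup-map j (u0 KK.*_) (coord v0)) (KF.*-comm u0 _)))) (sym (column-dot v u j)) ⟩
    (lookup (coord v0) j KK.* u0) KK.+ VK.dot (column v j) u ∎)
    where R = VL.dot v (Vec.map ι u)

  vec-ext0 : ∀ {m'} (w : Vec KK.Carrier m') → (∀ j → lookup w j ≡ KK.0#) → w ≡ VK.zeroV
  vec-ext0 [] h = refl
  vec-ext0 (x ∷ w) h = cong₂ _∷_ (h Fin.zero) (vec-ext0 w (λ j → h (Fin.suc j)))
    where import Data.Fin as Fin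

  coord-zero : ∀ z → (∀ j → lookup (coord z) j ≡ KK.0#) → z ≡ L.0#
  coord-zero z h = coord-inj (trans (vec-ext0 (coord z) h) (sym coord-0))

  column-∈ : ∀ v j → column v j ∈ columnsΓ v
  column-∈ v j = VecM.∈-toList⁺ (VecM.∈-map⁺ (column v) (VecM.∈-allFin⁺ j))

  ∈-column : ∀ {v x} → x ∈ columnsΓ v → ∃ λ j → x ≡ column v j
  ∈-column {v} {x} mx with ∈-map⁻ (column v) (subst (x ∈_) (VecP.toList-map (column v) (Vec.allFin m)) mx)
  ... | j , _ , e = j , e

  allColumns : ∀ {t} → Vec (Vec L.Carrier n) t → List Vn
  allColumns τ = concat (toList (Vec.map columnsΓ τ))

  ∈-allColumns⁻ : ∀ {t} (τ : Vec (Vec L.Carrier n) t) {x} → x ∈ allColumns τ → ∃ λ v → v ∈ toList τ × x ∈ columnsΓ v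
  ∈-allColumns⁻ τ {x} mx with ∈-concat⁻′ (toList (Vec.map columnsΓ τ)) mx
  ... | cs , mc , mcs with ∈-map⁻ columnsΓ (subst (cs ∈_) (VecP.toList-map columnsΓ τ) mcs)
  ...   | v , mv , refl = v , mv , mc

  ∈-allColumns⁺ : ∀ {t} (τ : Vec (Vec L.Carrier n) t) {x v} → v ∈ toList τ → x ∈ columnsΓ v → x ∈ allColumns τ
  ∈-allColumns⁺ τ mv mc = ∈-concat⁺′ mc (VecM.∈-toList⁺ (VecM.∈-map⁺ columnsΓ (VecM.∈-toList⁻ mv)))

  column∈SR : ∀ {t} (τ : Vec (Vec L.Carrier n) t) {v} j → v ∈ toList τ → column v j ∈ SR τ
  column∈SR τ {v} j mv = filterᵇ-∈⁺ (SK.spanᵇ (allColumns τ)) (SK.E-∈ _)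
    (SK.T-spanᵇ (allColumns τ) _ (SK.∈⇒InSpan (∈-allColumns⁺ τ mv (column-∈ v j))))

  ColumnsOrth : List Vn → Vec L.Carrier n → Set
  ColumnsOrth V v = ∀ j u → u ∈ V → VK.dot (column v j) u ≡ KK.0#

  annihilatesᵇ⇒ColumnsOrth : ∀ V v → T (annihilatesᵇ V v) → ColumnsOrth V v
  annihilatesᵇ⇒ColumnsOrth V v t j u mu = begin
    VK.dot (column v j) u                   ≡⟨ column-dot v u j ⟩
    lookup (coord (VL.dot v (Vec.map ι u))) j ≡⟨ cong (λ z → lookup (coord z) j) (LAL.isZeroᵇ⇒≡0 (all-T _ V t u mu)) ⟩
    lookup (coord L.0#) j                   ≡⟨ cong (λ z → lookup z j) coord-0 ⟩
    lookup VK.zeroV j                       ≡⟨ VecP.lookup-replicate j KK.0# ⟩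
    KK.0# ∎

  ColumnsOrth⇒annihilatesᵇ : ∀ V v → ColumnsOrth V v → T (annihilatesᵇ V v)
  ColumnsOrth⇒annihilatesᵇ V v h = T-all _ V (λ u mu → LAL.≡0⇒isZeroᵇ (coord-zero _ (λ j → trans (sym (column-dot v u j)) (h j u mu))))

  SR⊆orth≡all-annihilateᵇ : ∀ {t} (τ : Vec (Vec L.Carrier n) t) V → (SR τ ⊆ᵇ orth V) ≡ all (annihilatesᵇ V) (toList τ)
  SR⊆orth≡all-annihilateᵇ τ V = T-ext to from
    where
    to : T (SR τ ⊆ᵇ orth V) → T (all (annihilatesᵇ V) (toList τ))
    to t = T-all _ (toList τ) (λ v mv → ColumnsOrth⇒annihilatesᵇ V v (λ j u mu →
      SK.sol-T {V} {column v j} (SK.orth-∈⁻ {V} {column v j} (SK.⊆-T {SR τ} {orth V} t (column v j) (column∈SR τ j mv))) u mu))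
    from : T (all (annihilatesᵇ V) (toList τ)) → T (SR τ ⊆ᵇ orth V)
    from h = SK.T-⊆ {SR τ} {orth V} (λ x mx →
      let (cs , _ , e) = SK.spanᵇ-T (allColumns τ) x (proj₂ (filterᵇ-∈⁻ (SK.spanᵇ (allColumns τ)) {x} {E} mx))
      in SK.orth-∈⁺ {V} {x} (SK.T-sol {V} {x} (λ u mu → subst (λ z → VK.dot z u ≡ KK.0#) e
           (KF.dot-lincombˡ u cs (allColumns τ) (All-tab (allColumns τ) (λ col mcol →
             let (v , mv , mc) = ∈-allColumns⁻ τ mcol ; (j , col≡) = ∈-column mc
             in trans (cong (λ z → VK.dot z u) col≡) (annihilatesᵇ⇒ColumnsOrth V v (all-T _ (toList τ) h v mv) j u mu)))))))

  zeroV∈codewords : VL.zeroV ∈ codewords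
  zeroV∈codewords = filterᵇ-∈⁺ inCᵇ (LAL.allVecs-∈ n VL.zeroV) (subst (T ∘ inCᵇ) codeword-0 (codeword-inC VL.zeroV))

  subcodeSize≥1 : ∀ V → 1 ≤ subcodeSize V
  subcodeSize≥1 V = ℕP.≤-trans (ℕP.≤-reflexive (sym (T⇒𝟙≡1 zero-annihilates))) (∑-term codewords (𝟙 ∘ annihilatesᵇ V) _ zeroV∈codewords)
    where
    zero-annihilates : T (annihilatesᵇ V VL.zeroV)
    zero-annihilates = T-all _ V (λ u _ → LAL.≡0⇒isZeroᵇ (LF.dot-0ˡ (Vec.map ι u)))

  subcodeSize-anti : ∀ A B → T (A ⊆ᵇ B) → subcodeSize B ≤ subcodeSize A
  subcodeSize-anti A B A⊆B = count-mono codewords (annihilatesᵇ B) (annihilatesᵇ A)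
    (λ v _ tv → T-all _ A (λ u mu → all-T _ B tv u (SK.⊆-T {A} {B} A⊆B u mu)))

  ρ≤ρE : ∀ V → ρ V ≤ ρ E
  ρ≤ρE V = proj₁ (c*Q^a≡Q^b⇒ Q Q≥2 (subcodeSize V) (ρ V) (ρ E) (subcodeSize≥1 V) (subcodeSize*Q^ρ≡Q^ρE V))

  subcodeSize≡Q^corank : ∀ V → subcodeSize V ≡ Q ^ (ρ E ∸ ρ V)
  subcodeSize≡Q^corank V = proj₂ (c*Q^a≡Q^b⇒ Q Q≥2 (subcodeSize V) (ρ V) (ρ E) (subcodeSize≥1 V) (subcodeSize*Q^ρ≡Q^ρE V))

  ρ-mono : ∀ A B → T (A ⊆ᵇ B) → ρ A ≤ ρ B
  ρ-mono A B A⊆B = ℕP.∸-cancelʳ-≤ (ρ≤ρE A) (^-cancelʳ-≤ Q Q≥2 _ _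
    (subst₂ _≤_ (subcodeSize≡Q^corank B) (subcodeSize≡Q^corank A) (subcodeSize-anti A B A⊆B)))

module TupleCount (K : FiniteField) (m : ℕ) (X : Extension K m) (k n : ℕ)
                  (G : Vec (Vec (Field.Carrier (Extension.L X)) n) k) (t : ℕ) where

  open import Data.Bool using (T)
  open import Data.Nat using (_^_; _∸_) renaming (_*_ to _*ℕ_)
  open import Data.Integer using (+_) renaming (_^_ to _^ℤ_)
  open import Relation.Binary.PropositionalEquality
  open Counting
  open Enumeration using (count-all-tuples)
  open IntegerSums using (pos-^)
  open PowerArithmetic

  open Subspaces K n using (Vn; E; orth; _⊆ᵇ_)
  open Code X G using (ρ; codewords; SR)
  open CodeCounting K m X k n G using (subcodeSize; annihilatesᵇ; SR⊆orth≡all-annihilateᵇ; subcodeSize≡Q^corank; ρ≤ρE; ρ-mono)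
  open ExtensionField K m X using (Q; Q≡q^m)
  open FiniteField K using (q)
  open Extension X using (L)

  tuples : List (Vec (Vec (Field.Carrier L) n) t)
  tuples = allVecs codewords t

  tuplesInside : List Vn → ℕ
  tuplesInside V = ∑ tuples (λ τ → 𝟙 (SR τ ⊆ᵇ orth V))

  tuplesInside≡subcodeSize^t : ∀ V → tuplesInside V ≡ subcodeSize V ^ t
  tuplesInside≡subcodeSize^t V = trans (∑-cong tuples (λ τ _ → cong 𝟙 (SR⊆orth≡all-annihilateᵇ τ V)))
                                       (count-all-tuples codewords (annihilatesᵇ V) t)

  -- The exponent is the corank of V in the contraction by U.
  x^corank≡tuplesInside : ∀ U V → T (U ⊆ᵇ V) →
    (+ (q ^ (m *ℕ t))) ^ℤ ((ρ E ∸ ρ U) ∸ (ρ V ∸ ρ U)) ≡ + tuplesInside V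
  x^corank≡tuplesInside U V U⊆V = begin
    (+ x) ^ℤ ((ρ E ∸ ρ U) ∸ (ρ V ∸ ρ U)) ≡⟨ sym (pos-^ x ((ρ E ∸ ρ U) ∸ (ρ V ∸ ρ U))) ⟩
    + (x ^ ((ρ E ∸ ρ U) ∸ (ρ V ∸ ρ U)))  ≡⟨ cong (λ e → + (x ^ e)) (∸-∸-cancel (ρ E) (ρ V) (ρ U) (ρ-mono U V U⊆V) (ρ≤ρE V)) ⟩
    + (x ^ (ρ E ∸ ρ V))                  ≡⟨ cong +_ (^-*-swap q m t (ρ E ∸ ρ V)) ⟩
    + (((q ^ m) ^ (ρ E ∸ ρ V)) ^ t)      ≡⟨ cong (λ z → + ((z ^ (ρ E ∸ ρ V)) ^ t)) (sym Q≡q^m) ⟩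
    + ((Q ^ (ρ E ∸ ρ V)) ^ t)            ≡⟨ cong (λ z → + (z ^ t)) (sym (subcodeSize≡Q^corank V)) ⟩
    + (subcodeSize V ^ t)                ≡⟨ cong +_ (sym (tuplesInside≡subcodeSize^t V)) ⟩
    + tuplesInside V ∎
    where
    open ≡-Reasoning
    x = q ^ (m *ℕ t)

module SupportCount (K : FiniteField) (m : ℕ) (X : Extension K m) (k n : ℕ)
                    (G : Vec (Vec (Field.Carrier (Extension.L X)) n) k)
                    (W : List (Vec (FiniteField.Carrier K) n)) (W-subspace : W ∈ Subspaces.subspaces K n)
                    (t : ℕ) where

  open import Data.Bool using (Bool; T; _∧_)
  open import Data.Bool.Properties using (T-≡; ∧-identityˡ)
  open import Data.Integer using (ℤ; +_) renaming (_*_ to _*ℤ_)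
  open import Data.Product using (_×_; proj₂)
  open import Function using (_∘_; Equivalence)
  open import Relation.Binary.PropositionalEquality
  open Counting
  open Enumeration using (filterᵇ-∈⁻)
  open IntegerSums using (∑ℤ; ∑ℤ-cong)

  open Subspaces K n using (Vn; subspaces; orth; _⊆ᵇ_; sameᵇ)
  module SK = SubspaceFacts K n
  open Code X G using (inducedQMatroid; SR)
  open CodeCounting K m X k n G using (allColumns)
  open TupleCount K m X k n G t public

  W⊥ : List Vn
  W⊥ = orth W

  M/W⊥ : LatticeRank
  M/W⊥ = contract inducedQMatroid W⊥

  module M/W⊥ = LatticeRank M/W⊥
  open Moebius M/W⊥ SK.⊆ᵇ-refl SK.⊆ᵇ-trans (λ _ _ → refl) using (∑-μ-interval)

  μ-weighted : (List Vn → ℤ) → ℤ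
  μ-weighted f = ∑ℤ M/W⊥.elems (λ V → M/W⊥.μ W⊥ V *ℤ f V)

  above-W⊥ : ∀ {V} → V ∈ M/W⊥.elems → V ∈ subspaces × T (W⊥ ⊆ᵇ V)
  above-W⊥ {V} = filterᵇ-∈⁻ (W⊥ ⊆ᵇ_) {V} {subspaces}

  -- S_R(τ) ⊆ V⊥ iff V ⊆ S_R(τ)⊥, so the sum runs over the interval [W⊥, S_R(τ)⊥].
  μ-weighted-tuple : (τ : Vec (Vec (Field.Carrier (Extension.L X)) n) t) → μ-weighted (λ V → + 𝟙 (SR τ ⊆ᵇ orth V)) ≡ + 𝟙 (sameᵇ (SR τ) W)
  μ-weighted-tuple τ = begin
    μ-weighted (λ V → + 𝟙 (SR τ ⊆ᵇ orth V))
      ≡⟨ ∑ℤ-cong M/W⊥.elems (λ V mV → cong (λ b → M/W⊥.μ W⊥ V *ℤ + 𝟙 b) (in-interval V mV)) ⟩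
    μ-weighted (λ V → + 𝟙 ((W⊥ ⊆ᵇ V) ∧ (V ⊆ᵇ orth (SR τ))))
      ≡⟨ ∑-μ-interval W⊥ (orth (SR τ)) (SK.∑-sameᵇ-above W⊥ (SK.orth∈subspaces (SR τ))) ⟩
    + 𝟙 (sameᵇ W⊥ (orth (SR τ)))
      ≡⟨ cong (+_ ∘ 𝟙) (SK.sameᵇ-orth W (SR τ) W-subspace (SK.span∈subspaces (allColumns τ))) ⟩
    + 𝟙 (sameᵇ (SR τ) W) ∎
    where
    open ≡-Reasoning
    in-interval : ∀ V → V ∈ M/W⊥.elems → (SR τ ⊆ᵇ orth V) ≡ ((W⊥ ⊆ᵇ V) ∧ (V ⊆ᵇ orth (SR τ)))
    in-interval V mV = trans (SK.⊆ᵇ-orth-comm (SR τ) V)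
      (sym (trans (cong (_∧ (V ⊆ᵇ orth (SR τ))) (Equivalence.to T-≡ (proj₂ (above-W⊥ mV)))) (∧-identityˡ _)))

open import Data.Nat using (_≤_; _*_; _^_)
open import Data.Integer using (+_) renaming (_*_ to _*ℤ_)
open import Data.Product using (proj₂)
open import Relation.Binary.PropositionalEquality using (sym; cong; module ≡-Reasoning)
open Counting using (𝟙)
open IntegerSums using (∑ℤ; ∑ℤ-cong; ∑ℤ-𝟙; ∑ℤ-*-pos-∑)

-- The hypothesis 1 ≤ t is unused: the identity also holds for t = 0.
theorem6p20 : (K : FiniteField) (m : ℕ) (Ext : Extension K m) (k n : ℕ)
  (G : Vec (Vec (Field.Carrier (Extension.L Ext)) n) k)
  (W : List (Vec (FiniteField.Carrier K) n)) → W ∈ Subspaces.subspaces K n →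
  (t : ℕ) → 1 ≤ t →
  + (Code.countTuples Ext G t W)
    ≡ LatticeRank.charPoly
        (contract (Code.inducedQMatroid Ext G) (Subspaces.orth K n W))
        (+ (FiniteField.q K ^ (m * t)))
theorem6p20 K m X k n G W W-subspace t _ = sym (begin
  M/W⊥.charPoly (+ (q ^ (m * t)))
    ≡⟨ ∑ℤ-cong M/W⊥.elems (λ V mV → cong (M/W⊥.μ W⊥ V *ℤ_) (x^corank≡tuplesInside W⊥ V (proj₂ (above-W⊥ mV)))) ⟩
  μ-weighted (λ V → + tuplesInside V)
    ≡⟨ ∑ℤ-*-pos-∑ M/W⊥.elems tuples (M/W⊥.μ W⊥) (λ V τ → 𝟙 (SR τ ⊆ᵇ orth V)) ⟩
  ∑ℤ tuples (λ τ → μ-weighted (λ V → + 𝟙 (SR τ ⊆ᵇ orth V)))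
    ≡⟨ ∑ℤ-cong tuples (λ τ _ → μ-weighted-tuple τ) ⟩
  ∑ℤ tuples (λ τ → + 𝟙 (sameᵇ (SR τ) W))
    ≡⟨ ∑ℤ-𝟙 (λ τ → sameᵇ (SR τ) W) tuples ⟩
  + countTuples t W ∎)
  where
  open SupportCount K m X k n G W W-subspace t
  open Subspaces K n using (orth; _⊆ᵇ_; sameᵇ)
  open Code X G using (SR; countTuples)
  open FiniteField K using (q)
  open ≡-Reasoning
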